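{- Let $m\ge 1$. Odd case: let $n=2m+1$ and $\pi\in S_n$. (1) If $2\le r\le m+1$ and $\pi$ is $r$-toppleable, then $\pi$ is $(r-1)$-toppleable. (2) If $m+2\le r\le 2m$ and $\pi$ is $r$-toppleable, then $\pi$ is $(r+1)$-toppleable. (3) $\pi$ is $(m+1)$-toppleable if and only if $\pi$ is $(m+2)$-toppleable. Even case: let $n=2m$ and $\pi\in S_n$. (1) If $2\le r\le m+1$ and $\pi$ is $r$-toppleable, then $\pi$ is $(r-1)$-toppleable. (2) If $m+2\le r\le n$ and $\pi$ is $r$-toppleable, then $\pi$ is $(r+1)$-toppleable. (3) $\pi$ is $(m+1)$-toppleable if and only if $\pi$ is $(m+2)$-toppleable.
   Context: For an integer $n\ge 2$ let $L_n=\{ -\lfloor (n+1)/2\rfloor,\dots,\lfloor n/2\rfloor+1\}\subset\mathbb{Z}$; position $0$ is the origin. A toppling move chooses a position $i$ holding at least two chips, chooses two chips $\alpha<\beta$ at $i$, and moves $\alpha$ to $i-1$ and $\beta$ to $i+1$; the toppling process applies such moves (arbitrary choices) until no position holds two or more chips. For $\pi\in S_n$ and $r\in[n+1]$, the initial configuration $\pi^{(r)}$ has, for $j=1,\dots,n$, one chip at position $-\lfloor (n-1)/2\rfloor+j-1$ labeled $\pi_j$ if $\pi_j<r$ and $\pi_j+1$ if $\pi_j\ge r$, plus a chip labeled $r$ at the origin. The final configuration does not depend on the choices and has at most one chip per position; reading chips left to right gives $\mathcal{T}(\pi,r)\in S_{n+1}$. $\pi$ is $r$-toppleable if $\mathcal{T}(\pi,r)$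 is the identity permutation. -}

module Defs where

open import Data.Nat as ℕ using (ℕ; zero; suc; _∸_; _<ᵇ_)
open import Data.Nat.DivMod using (_/_)
open import Data.Integer as ℤ using (ℤ; +_; -_)
open import Data.Fin using (Fin; toℕ)
open import Data.Fin.Permutation using (Permutation′; _⟨$⟩ʳ_)
open import Data.List using (List; []; _∷_; map; zip; length; upTo; allFin)
open import Data.List.Relation.Binary.Permutation.Propositional using (_↭_)
open import Data.List.Relation.Unary.AllPairs using (AllPairs)
open import Data.List.Relation.Unary.Linked using (Linked)
open import Data.Product using (_×_; _,_; proj₁; ∃)
open import Data.Bool using (if_then_else_)
open import Relation.Binary.PropositionalEquality using (_≡_; _≢_)
open import Relation.Binary.Construct.Closure.ReflexiveTransitive using (Star)

-- A chip is (position , label). A configuration is a finite multiset of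
-- chips, represented by a list considered up to permutation (_↭_).
Chip : Set
Chip = ℤ × ℕ

Config : Set
Config = List Chip

data _⟶_ : Config → Config → Set where
  move : ∀ {c rest : Config} {i : ℤ} {α β : ℕ} →
         c ↭ ((i , α) ∷ (i , β) ∷ rest) → α ℕ.< β →
         c ⟶ ((i ℤ.- ℤ.1ℤ , α) ∷ (i ℤ.+ ℤ.1ℤ , β) ∷ rest)

_⟶*_ : Config → Config → Set
_⟶*_ = Star _⟶_

Stable : Config → Set
Stable c = AllPairs (λ x y → proj₁ x ≢ proj₁ y) c

ReadsIdentity : ℕ → Config → Set
ReadsIdentity n c =
  ∃ λ (ps : List ℤ) → length ps ≡ suc n × Linked ℤ._<_ ps
    × c ↭ zip ps (map suc (upTo (suc n)))

relabel : ℕ → ℕ → ℕ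
relabel r k = if k <ᵇ r then k else suc k

initial : (n : ℕ) → Permutation′ n → ℕ → Config
initial n π r =
  (+ 0 , r) ∷
  map (λ (j : Fin n) →
         ((- (+ ((n ∸ 1) / 2))) ℤ.+ (+ toℕ j) ,
          relabel r (suc (toℕ (π ⟨$⟩ʳ j)))))
      (allFin n)

-- T(π,r) = id: the toppling process from π^(r) reaches a final (stable)
-- configuration which reads as the identity permutation. (The final
-- configuration is independent of the choices, as stated in the paper.)
Toppleable : (n : ℕ) → Permutation′ n → ℕ → Set
Toppleable n π r =
  ∃ λ (c : Config) → initial n π r ⟶* c × Stable c × ReadsIdentity n c

{-# OPTIONS --safe #-}
-- Toppling π^(r) runs a comparator grid. The chips at positions ≤ 0 other than r are R rows
-- moving right, r and the chips at positions > 0 are C columns moving left, and every move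
-- is the crossing of a row and a column, after which the column carries the smaller label.
-- Any toppling sequence performs all R · C crossings in an order compatible with the grid,
-- so the final configuration is the column outputs followed by the row outputs, and π is
-- r-toppleable iff these read 1, …, n + 1. By the 0-1 principle this may be checked after
-- thresholding all labels at each k, where the outputs have a closed form in terms of
-- numbers of zeros and ones. Passing from r + 1 to r changes only the threshold-r inputs:
-- a 1 moves from the chip at the origin to the chip labelled r. For r ≤ C this move
-- preserves sorted outputs and for r ≥ C its inverse does; in both the odd and the even
-- case C = m + 1.
module Submission where

open import Data.Bool using (Bool; true; false; _∧_; _∨_; not; if_then_else_)
open import Data.Bool.Properties
  using (T-≡; ∧-comm; ∨-comm; ∧-identityʳ; ∨-identityʳ; ∧-zeroʳ; ∨-zeroʳ)
open import Data.Fin as Fin using (Fin; toℕ; fromℕ<)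
import Data.Fin.Properties as Fin
open import Data.Fin.Permutation using (Permutation′; _⟨$⟩ʳ_; _⟨$⟩ˡ_; inverseˡ; inverseʳ)
open import Data.Integer as ℤ using (ℤ; _⊖_)
import Data.Integer.Properties as ℤP
open import Data.List using (List; []; _∷_; _++_; applyUpTo; map; zip; length; upTo; tabulate; allFin)
open import Data.List.Properties
  using (∷-injective; length-map; length-applyUpTo; length-upTo; map-upTo; map-applyUpTo; map-tabulate)
open import Data.List.Membership.Propositional using (_∈_)
open import Data.List.Membership.Propositional.Properties using (∈-++⁻; ∈-applyUpTo⁻)
open import Data.List.Relation.Unary.Any using (here; there)
open import Data.List.Relation.Unary.All as All using (All; []; _∷_)
import Data.List.Relation.Unary.All.Properties as All
open import Data.List.Relation.Unary.AllPairs as AllPairs using (AllPairs; []; _∷_)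
import Data.List.Relation.Unary.AllPairs.Properties as AllPairs
open import Data.List.Relation.Unary.Linked using (Linked; []; [-]; _∷_)
import Data.List.Relation.Unary.Linked.Properties as Linked
open import Data.List.Relation.Binary.Permutation.Propositional
  using (_↭_; prep; swap; ↭-sym; ↭-trans; ↭-refl; ↭-reflexive; ↭⇒↭ₛ)
open import Data.List.Relation.Binary.Permutation.Propositional.Properties
  using (++⁺; ++-comm; shift; drop-∷; ∈-resp-↭; ↭-empty-inv; ¬x∷xs↭[])
import Data.List.Relation.Binary.Permutation.Setoid.Properties as Permutationₛ
open import Data.Nat
open import Data.Nat.DivMod using (_/_; m*n/n≡m; m/n≡1+[m∸n]/n)
open import Data.Nat.Properties
open import Data.Product using (_×_; _,_; proj₁; proj₂; Σ)
open import Data.Sum using (_⊎_; inj₁; inj₂)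
open import Function using (_∘_; id)
open import Function.Bundles using (_⇔_; Equivalence; mk⇔)
open import Function.Construct.Composition using (_⇔-∘_)
open import Relation.Binary.Construct.Closure.ReflexiveTransitive using (ε; _◅_)
open import Relation.Binary.Definitions using (Symmetric; Tri; tri<; tri≈; tri>)
open import Relation.Binary.PropositionalEquality
open import Relation.Nullary using (¬_; yes; no; contradiction)

open import Defs

<⇒<ᵇ≡true : ∀ {m n} → m < n → (m <ᵇ n) ≡ true
<⇒<ᵇ≡true m<n = Equivalence.to T-≡ (<⇒<ᵇ m<n)

<ᵇ≡true⇒< : ∀ {m n} → (m <ᵇ n) ≡ true → m < n
<ᵇ≡true⇒< {m} {n} e = <ᵇ⇒< m n (Equivalence.from T-≡ e)

≥⇒<ᵇ≡false : ∀ {m n} → m ≥ n → (m <ᵇ n) ≡ false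
≥⇒<ᵇ≡false {m} {n} m≥n with m <ᵇ n in e
... | false = refl
... | true  = contradiction (<ᵇ≡true⇒< e) (≤⇒≯ m≥n)

<ᵇ≡false⇒≥ : ∀ {m n} → (m <ᵇ n) ≡ false → m ≥ n
<ᵇ≡false⇒≥ e = ≮⇒≥ λ m<n → contradiction (trans (sym (<⇒<ᵇ≡true m<n)) e) λ ()

<ᵇ-monoʳ : ∀ {k m n} → m ≤ n → (k <ᵇ m) ≡ true → (k <ᵇ n) ≡ true
<ᵇ-monoʳ m≤n e = <⇒<ᵇ≡true (<-≤-trans (<ᵇ≡true⇒< e) m≤n)

implies⇒∧≡ˡ : ∀ {b c} → (b ≡ true → c ≡ true) → b ∧ c ≡ b
implies⇒∧≡ˡ {true}  b⇒c = b⇒c refl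
implies⇒∧≡ˡ {false} b⇒c = refl

implies⇒∨≡ʳ : ∀ {b c} → (b ≡ true → c ≡ true) → b ∨ c ≡ c
implies⇒∨≡ʳ {true}  b⇒c = sym (b⇒c refl)
implies⇒∨≡ʳ {false} b⇒c = refl

<ᵇ-distribˡ-⊓ : ∀ k m n → (k <ᵇ m ⊓ n) ≡ (k <ᵇ m) ∧ (k <ᵇ n)
<ᵇ-distribˡ-⊓ k m n with ≤-total m n
... | inj₁ m≤n = trans (cong (k <ᵇ_) (m≤n⇒m⊓n≡m m≤n)) (sym (implies⇒∧≡ˡ (<ᵇ-monoʳ m≤n)))
... | inj₂ n≤m = trans (cong (k <ᵇ_) (m≥n⇒m⊓n≡n n≤m))
                       (sym (trans (∧-comm (k <ᵇ m) _) (implies⇒∧≡ˡ (<ᵇ-monoʳ n≤m))))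

<ᵇ-distribˡ-⊔ : ∀ k m n → (k <ᵇ m ⊔ n) ≡ (k <ᵇ m) ∨ (k <ᵇ n)
<ᵇ-distribˡ-⊔ k m n with ≤-total m n
... | inj₁ m≤n = trans (cong (k <ᵇ_) (m≤n⇒m⊔n≡n m≤n)) (sym (implies⇒∨≡ʳ (<ᵇ-monoʳ m≤n)))
... | inj₂ n≤m = trans (cong (k <ᵇ_) (m≥n⇒m⊔n≡m n≤m))
                       (sym (trans (∨-comm (k <ᵇ m) _) (implies⇒∨≡ʳ (<ᵇ-monoʳ n≤m))))

thresholds-injective : ∀ {m n} → (∀ k → (k <ᵇ m) ≡ (k <ᵇ n)) → m ≡ n
thresholds-injective {m} {n} h with <-cmp m n
... | tri≈ _ m≡n _ = m≡n
... | tri< m<n _ _ =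
  contradiction (trans (sym (≥⇒<ᵇ≡false {m} ≤-refl)) (trans (h m) (<⇒<ᵇ≡true m<n))) λ ()
... | tri> _ _ n<m =
  contradiction (trans (sym (≥⇒<ᵇ≡false {n} ≤-refl)) (trans (sym (h n)) (<⇒<ᵇ≡true n<m))) λ ()

-- The comparator grid

-- col T L i j is the label of column j after crossing rows 0 … i-1, and row T L i j the
-- label of row i after crossing columns 0 … j-1.
mutual
  col : (ℕ → ℕ) → (ℕ → ℕ) → ℕ → ℕ → ℕ
  col T L zero    j = T j
  col T L (suc i) j = col T L i j ⊓ row T L i j

  row : (ℕ → ℕ) → (ℕ → ℕ) → ℕ → ℕ → ℕ
  row T L i zero    = L i
  row T L i (suc j) = col T L i j ⊔ row T L i j

bit : Bool → ℕ
bit b = if b then 1 else 0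

ones : (ℕ → Bool) → ℕ → ℕ
ones A zero    = 0
ones A (suc j) = bit (A j) + ones A j

zeros : (ℕ → Bool) → ℕ → ℕ
zeros B = ones (not ∘ B)

threshold : ℕ → (ℕ → ℕ) → ℕ → Bool
threshold k f x = k <ᵇ f x

-- Thresholding commutes with ⊓ and ⊔, and in the thresholded grid the 1 of column j survives
-- row i iff it is not among the first (zeros of rows < i) ones of the columns.
module _ (k : ℕ) (T L : ℕ → ℕ) where
  private
    A B : ℕ → Bool
    A = threshold k T
    B = threshold k L

  mutual
    col-threshold : ∀ i j → (k <ᵇ col T L i j) ≡ A j ∧ (zeros B i <ᵇ ones A (suc j))
    col-threshold zero j with A j
    ... | true  = refl
    ... | false = refl
    col-threshold (suc i) j = begin
      (k <ᵇ col T L i j ⊓ row T L i j)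
        ≡⟨ <ᵇ-distribˡ-⊓ k (col T L i j) _ ⟩
      (k <ᵇ col T L i j) ∧ (k <ᵇ row T L i j)
        ≡⟨ cong₂ _∧_ (col-threshold i j) (row-threshold i j) ⟩
      (A j ∧ (z <ᵇ ones A (suc j))) ∧ (B i ∨ (z <ᵇ ones A j))
        ≡⟨ meet (A j) (B i) (ones A j) ⟩
      A j ∧ (zeros B (suc i) <ᵇ ones A (suc j))
        ∎
      where
      open ≡-Reasoning
      z : ℕ
      z = zeros B i
      meet : ∀ a b q → (a ∧ (z <ᵇ bit a + q)) ∧ (b ∨ (z <ᵇ q))
                     ≡ a ∧ (bit (not b) + z <ᵇ bit a + q)
      meet false b     q = refl
      meet true  true  q = ∧-identityʳ _
      meet true  false q = trans (∧-comm (z <ᵇ suc q) _) (implies⇒∧≡ˡ (<ᵇ-monoʳ (n≤1+n q)))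

    row-threshold : ∀ i j → (k <ᵇ row T L i j) ≡ B i ∨ (zeros B i <ᵇ ones A j)
    row-threshold i zero    = sym (∨-identityʳ _)
    row-threshold i (suc j) = begin
      (k <ᵇ col T L i j ⊔ row T L i j)
        ≡⟨ <ᵇ-distribˡ-⊔ k (col T L i j) _ ⟩
      (k <ᵇ col T L i j) ∨ (k <ᵇ row T L i j)
        ≡⟨ cong₂ _∨_ (col-threshold i j) (row-threshold i j) ⟩
      (A j ∧ (z <ᵇ ones A (suc j))) ∨ (B i ∨ (z <ᵇ ones A j))
        ≡⟨ join (A j) (B i) (ones A j) ⟩
      B i ∨ (z <ᵇ ones A (suc j))
        ∎
      where
      open ≡-Reasoning
      z : ℕ
      z = zeros B i
      join : ∀ a b q → (a ∧ (z <ᵇ bit a + q)) ∨ (b ∨ (z <ᵇ q))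
                     ≡ b ∨ (z <ᵇ bit a + q)
      join false b     q = refl
      join true  true  q = ∨-zeroʳ _
      join true  false q = trans (∨-comm (z <ᵇ suc q) _) (implies⇒∨≡ʳ (<ᵇ-monoʳ (n≤1+n q)))

ones-mono : ∀ A {j j′} → j ≤ j′ → ones A j ≤ ones A j′
ones-mono A {j′ = zero}   z≤n  = ≤-refl
ones-mono A {j′ = suc j′} j≤1+j′ with m≤n⇒m<n∨m≡n j≤1+j′
... | inj₂ refl   = ≤-refl
... | inj₁ j<1+j′ = ≤-trans (ones-mono A (s≤s⁻¹ j<1+j′)) (m≤n+m _ _)

ones-cong : ∀ {A A′} → (∀ c → A′ c ≡ A c) → ∀ j → ones A′ j ≡ ones A j
ones-cong A′≗A zero    = refl
ones-cong A′≗A (suc j) = cong₂ (λ b n → bit b + n) (A′≗A j) (ones-cong A′≗A j)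

ones-true-< : ∀ A {c j} → A c ≡ true → c < j → ones A c < ones A j
ones-true-< A {c} {j} Ac c<j = subst (λ b → bit b + ones A c ≤ ones A j) Ac (ones-mono A c<j)

module _ {A A′ : ℕ → Bool} {p : ℕ} (agree : ∀ c → c ≢ p → A′ c ≡ A c) where

  ones-agree-≤ : ∀ j → j ≤ p → ones A′ j ≡ ones A j
  ones-agree-≤ zero    _     = refl
  ones-agree-≤ (suc j) 1+j≤p =
    cong₂ (λ b n → bit b + n) (agree j (<⇒≢ 1+j≤p)) (ones-agree-≤ j (<⇒≤ 1+j≤p))

  ones-flip-> : A p ≡ false → A′ p ≡ true → ∀ j → p < j → ones A′ j ≡ suc (ones A j)
  ones-flip-> Ap A′p (suc j) (s≤s p≤j) with m≤n⇒m<n∨m≡n p≤j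
  ... | inj₂ refl rewrite Ap | A′p = cong suc (ones-agree-≤ p ≤-refl)
  ... | inj₁ p<j rewrite agree j (>⇒≢ p<j) =
    trans (cong (bit (A j) +_) (ones-flip-> Ap A′p j p<j)) (+-suc _ _)

module _ {X Y : ℕ → Bool} {p : ℕ} (X0 : X 0 ≡ true) (Y0 : Y 0 ≡ false)
         (agree : ∀ c → c ≢ 0 → c ≢ p → Y c ≡ X c) where

  ones-moved-≤ : ∀ j → 1 ≤ j → j ≤ p → suc (ones Y j) ≡ ones X j
  ones-moved-≤ (suc zero)    _ _ rewrite X0 | Y0 = refl
  ones-moved-≤ (suc (suc j)) _ 2+j≤p = begin
    suc (bit (Y (suc j)) + ones Y (suc j))
      ≡⟨ cong (λ b → suc (bit b + _)) (agree (suc j) (λ ()) (<⇒≢ 2+j≤p)) ⟩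
    suc (bit (X (suc j)) + ones Y (suc j))
      ≡⟨ sym (+-suc _ _) ⟩
    bit (X (suc j)) + suc (ones Y (suc j))
      ≡⟨ cong (bit (X (suc j)) +_) (ones-moved-≤ (suc j) (s≤s z≤n) (<⇒≤ 2+j≤p)) ⟩
    bit (X (suc j)) + ones X (suc j)
      ∎
    where open ≡-Reasoning

  ones-moved-> : 1 ≤ p → X p ≡ false → Y p ≡ true → ∀ j → p < j → ones Y j ≡ ones X j
  ones-moved-> 1≤p Xp Yp (suc j) (s≤s p≤j) with m≤n⇒m<n∨m≡n p≤j
  ... | inj₂ refl rewrite Xp | Yp = ones-moved-≤ j 1≤p ≤-refl
  ... | inj₁ p<j rewrite agree j (>⇒≢ (<-trans 1≤p p<j)) (>⇒≢ p<j) =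
    cong (bit (X j) +_) (ones-moved-> 1≤p Xp Yp j p<j)

-- Outputs of the thresholded grid

module Outputs (R C : ℕ) where

  -- The outputs of the grid with thresholded inputs A and B (col-threshold at i = R,
  -- row-threshold at j = C).
  bottom : (ℕ → Bool) → (ℕ → Bool) → ℕ → Bool
  bottom A B j = A j ∧ (zeros B R <ᵇ ones A (suc j))

  right : (ℕ → Bool) → (ℕ → Bool) → ℕ → Bool
  right A B i = B i ∨ (zeros B i <ᵇ ones A C)

  -- Read as the identity, column j exits with label j + 1 and row i with label C + R - i.
  rowLabel : ℕ → ℕ
  rowLabel i = suc (C + (R ∸ suc i))

  record IdentityAt (k : ℕ) (A B : ℕ → Bool) : Set where
    field
      bottom-id : ∀ j → j < C → bottom A B j ≡ (k <ᵇ suc j)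
      right-id  : ∀ i → i < R → right A B i ≡ (k <ᵇ rowLabel i)

  bottom-false : ∀ {A B j} → ones A (suc j) ≤ zeros B R → bottom A B j ≡ false
  bottom-false {A} {j = j} le = trans (cong (A j ∧_) (≥⇒<ᵇ≡false le)) (∧-zeroʳ (A j))

  right-true : ∀ {A B i} → (B i ≡ false → zeros B i < ones A C) → right A B i ≡ true
  right-true {B = B} {i} lt with B i
  ... | true  = refl
  ... | false = <⇒<ᵇ≡true (lt refl)

  bottom-false⇒ones≤zeros : ∀ {A B} m → (∀ j → j < m → bottom A B j ≡ false) →
                            ones A m ≤ zeros B R
  bottom-false⇒ones≤zeros zero    _ = z≤n
  bottom-false⇒ones≤zeros {A} {B} (suc m) bot with A m in Am
  ... | true  =
    <ᵇ≡false⇒≥ (subst (λ b → b ∧ (zeros B R <ᵇ bit b + ones A m) ≡ false) Am (bot m ≤-refl))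
  ... | false = bottom-false⇒ones≤zeros m (λ j j<m → bot j (m<n⇒m<1+n j<m))

  right-true⇒zeros≤ones : ∀ {A B} s → (∀ i → i < s → right A B i ≡ true) →
                          zeros B s ≤ ones A C
  right-true⇒zeros≤ones zero    _ = z≤n
  right-true⇒zeros≤ones {A} {B} (suc s) rgt with B s in Bs
  ... | true  = right-true⇒zeros≤ones s (λ i i<s → rgt i (m<n⇒m<1+n i<s))
  ... | false = <ᵇ≡true⇒< (subst (λ b → b ∨ (zeros B s <ᵇ ones A C) ≡ true) Bs (rgt s ≤-refl))

  identityAt-cong : ∀ {k A B A′ B′} → (∀ c → A′ c ≡ A c) → (∀ i → B′ i ≡ B i) →
                    IdentityAt k A B → IdentityAt k A′ B′
  identityAt-cong {A = A} {B} {A′} {B′} A′≗A B′≗B idAB = record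
    { bottom-id = λ j j<C →
        trans (cong₂ _∧_ (A′≗A j) (cong₂ _<ᵇ_ (zeros≡ R) (ones-cong A′≗A (suc j)))) (bottom-id j j<C)
    ; right-id  = λ i i<R →
        trans (cong₂ _∨_ (B′≗B i) (cong₂ _<ᵇ_ (zeros≡ i) (ones-cong A′≗A C))) (right-id i i<R) }
    where
    open IdentityAt idAB
    zeros≡ : ∀ i → zeros B′ i ≡ zeros B i
    zeros≡ = ones-cong (cong not ∘ B′≗B)

  -- (Y , BY) is (X , BX) with the 1 of column 0 moved to column p or to row i₀.
  data CornerMoved (X BX Y BY : ℕ → Bool) : Set where
    toColumn : ∀ {p} → 1 ≤ p → p < C → X p ≡ false → Y p ≡ true →
               (∀ c → c ≢ 0 → c ≢ p → Y c ≡ X c) → (∀ i → BY i ≡ BX i) →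
               CornerMoved X BX Y BY
    toRow    : ∀ {i₀} → i₀ < R → BX i₀ ≡ false → BY i₀ ≡ true →
               (∀ i → i ≢ i₀ → BY i ≡ BX i) → (∀ c → c ≢ 0 → Y c ≡ X c) →
               CornerMoved X BX Y BY

  module SmallThreshold {k : ℕ} {X BX Y BY : ℕ → Bool}
                        (1≤k : 1 ≤ k) (k≤C : k ≤ C) (X0 : X 0 ≡ true) (Y0 : Y 0 ≡ false)
                        (idX : IdentityAt k X BX) where
    open IdentityAt idX
    open ≤-Reasoning

    rowTarget-true : ∀ i → (k <ᵇ rowLabel i) ≡ true
    rowTarget-true i = <⇒<ᵇ≡true (s≤s (≤-trans k≤C (m≤m+n C _)))

    onesX≤zerosBX : ones X k ≤ zeros BX R
    onesX≤zerosBX = bottom-false⇒ones≤zeros k λ j j<k →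
      trans (bottom-id j (<-≤-trans j<k k≤C)) (≥⇒<ᵇ≡false j<k)

    zerosBX≤onesX : zeros BX R ≤ ones X C
    zerosBX≤onesX = right-true⇒zeros≤ones R λ i i<R → trans (right-id i i<R) (rowTarget-true i)

    input-false⇒<k : ∀ {p} → p < C → X p ≡ false → p < k
    input-false⇒<k {p} p<C Xp = ≰⇒> λ k≤p → contradiction
      (trans (sym (cong (_∧ (zeros BX R <ᵇ ones X (suc p))) Xp))
             (trans (bottom-id p p<C) (<⇒<ᵇ≡true (s≤s k≤p))))
      λ ()

    viaColumn : ∀ {p} → 1 ≤ p → p < C → X p ≡ false → Y p ≡ true →
                (∀ c → c ≢ 0 → c ≢ p → Y c ≡ X c) → (∀ i → BY i ≡ BX i) → IdentityAt k Y BY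
    viaColumn {p} 1≤p p<C Xp Yp cols rows = record { bottom-id = bot ; right-id = rgt }
      where
      p<k : p < k
      p<k = input-false⇒<k p<C Xp
      zerosBY≡ : ∀ i → zeros BY i ≡ zeros BX i
      zerosBY≡ = ones-cong (λ i → cong not (rows i))
      onesY≡ : ∀ j → p < j → ones Y j ≡ ones X j
      onesY≡ = ones-moved-> X0 Y0 cols 1≤p Xp Yp
      bot : ∀ j → j < C → bottom Y BY j ≡ (k <ᵇ suc j)
      bot j j<C with j ≤? p
      ... | yes j≤p = trans (bottom-false {Y} {BY} {j} (begin
            ones Y (suc j)  ≤⟨ ones-mono Y (s≤s j≤p) ⟩
            ones Y (suc p)  ≡⟨ cong (λ b → bit b + ones Y p) Yp ⟩
            suc (ones Y p)  ≡⟨ ones-moved-≤ X0 Y0 cols p 1≤p ≤-refl ⟩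
            ones X p        ≤⟨ ones-mono X (<⇒≤ p<k) ⟩
            ones X k        ≤⟨ onesX≤zerosBX ⟩
            zeros BX R      ≡⟨ zerosBY≡ R ⟨
            zeros BY R      ∎))
          (sym (≥⇒<ᵇ≡false (≤-trans (s≤s j≤p) p<k)))
      ... | no j≰p = trans
            (cong₂ _∧_ (cols j (>⇒≢ (<-trans 1≤p p<j)) (>⇒≢ p<j))
                       (cong₂ _<ᵇ_ (zerosBY≡ R) (onesY≡ (suc j) (m<n⇒m<1+n p<j))))
            (bottom-id j j<C)
        where
        p<j : p < j
        p<j = ≰⇒> j≰p
      rgt : ∀ i → i < R → right Y BY i ≡ (k <ᵇ rowLabel i)
      rgt i i<R = trans (cong₂ _∨_ (rows i) (cong₂ _<ᵇ_ (zerosBY≡ i) (onesY≡ C p<C))) (right-id i i<R)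

    viaRow : ∀ {i₀} → i₀ < R → BX i₀ ≡ false → BY i₀ ≡ true →
             (∀ i → i ≢ i₀ → BY i ≡ BX i) → (∀ c → c ≢ 0 → Y c ≡ X c) → IdentityAt k Y BY
    viaRow {i₀} i₀<R BXi₀ BYi₀ rows cols = record { bottom-id = bot ; right-id = rgt }
      where
      onesX≡ : ∀ j → 0 < j → ones X j ≡ suc (ones Y j)
      onesX≡ = ones-flip-> (λ c c≢0 → sym (cols c c≢0)) Y0 X0
      zerosBX≡ : zeros BX R ≡ suc (zeros BY R)
      zerosBX≡ =
        ones-flip-> (λ i i≢i₀ → cong not (sym (rows i i≢i₀))) (cong not BYi₀) (cong not BXi₀) R i₀<R
      bot : ∀ j → j < C → bottom Y BY j ≡ (k <ᵇ suc j)
      bot zero    _   = trans (cong (_∧ (zeros BY R <ᵇ ones Y 1)) Y0) (sym (≥⇒<ᵇ≡false 1≤k))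
      bot (suc j) j<C = trans
        (cong₂ _∧_ (cols (suc j) λ ()) (cong₂ _<ᵇ_ (sym zerosBX≡) (sym (onesX≡ (suc (suc j)) z<s))))
        (bottom-id (suc j) j<C)
      zerosBY<onesY : ∀ {i} → i < R → BY i ≡ false → zeros BY i < ones Y C
      zerosBY<onesY {i} i<R BYi = s≤s⁻¹ (begin-strict
        suc (zeros BY i)     <⟨ s≤s (ones-true-< (not ∘ BY) (cong not BYi) i<R) ⟩
        suc (zeros BY R)     ≡⟨ zerosBX≡ ⟨
        zeros BX R           ≤⟨ zerosBX≤onesX ⟩
        ones X C             ≡⟨ onesX≡ C (≤-trans 1≤k k≤C) ⟩
        suc (ones Y C)       ∎)
      rgt : ∀ i → i < R → right Y BY i ≡ (k <ᵇ rowLabel i)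
      rgt i i<R = trans (right-true {Y} {BY} {i} (zerosBY<onesY i<R)) (sym (rowTarget-true i))

  module LargeThreshold {k : ℕ} {X BX Y BY : ℕ → Bool}
                        (1≤C : 1 ≤ C) (C≤k : C ≤ k) (X0 : X 0 ≡ true) (Y0 : Y 0 ≡ false)
                        (idY : IdentityAt k Y BY) where
    open IdentityAt idY
    open ≤-Reasoning

    bottomTarget-false : ∀ j → j < C → (k <ᵇ suc j) ≡ false
    bottomTarget-false j j<C = ≥⇒<ᵇ≡false (≤-trans j<C C≤k)

    onesY≤zerosBY : ones Y C ≤ zeros BY R
    onesY≤zerosBY =
      bottom-false⇒ones≤zeros C λ j j<C → trans (bottom-id j j<C) (bottomTarget-false j j<C)

    module _ {i₀} (i₀<R : i₀ < R) (BYi₀ : BY i₀ ≡ true) where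

      rowTarget-true : ∀ i → i ≤ i₀ → (k <ᵇ rowLabel i) ≡ true
      rowTarget-true i i≤i₀ = <ᵇ-monoʳ {k} (s≤s (+-monoʳ-≤ C (∸-monoʳ-≤ R (s≤s i≤i₀))))
        (trans (sym (right-id i₀ i₀<R)) (cong (_∨ (zeros BY i₀ <ᵇ ones Y C)) BYi₀))

      zerosBY<onesY : ∀ {i} → i < i₀ → BY i ≡ false → zeros BY i < ones Y C
      zerosBY<onesY {i} i<i₀ BYi = <ᵇ≡true⇒< (trans (sym (cong (_∨ (zeros BY i <ᵇ ones Y C)) BYi))
        (trans (right-id i (<-trans i<i₀ i₀<R)) (rowTarget-true i (<⇒≤ i<i₀))))

    viaColumn : ∀ {p} → 1 ≤ p → p < C → X p ≡ false → Y p ≡ true →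
                (∀ c → c ≢ 0 → c ≢ p → Y c ≡ X c) → (∀ i → BY i ≡ BX i) → IdentityAt k X BX
    viaColumn {p} 1≤p p<C Xp Yp cols rows = record { bottom-id = bot ; right-id = rgt }
      where
      zerosBY≡ : ∀ i → zeros BY i ≡ zeros BX i
      zerosBY≡ = ones-cong (λ i → cong not (rows i))
      onesY≡ : ones Y C ≡ ones X C
      onesY≡ = ones-moved-> X0 Y0 cols 1≤p Xp Yp C p<C
      bot : ∀ j → j < C → bottom X BX j ≡ (k <ᵇ suc j)
      bot j j<C = trans (bottom-false {X} {BX} {j} (begin
          ones X (suc j)  ≤⟨ ones-mono X j<C ⟩
          ones X C        ≡⟨ onesY≡ ⟨
          ones Y C        ≤⟨ onesY≤zerosBY ⟩
          zeros BY R      ≡⟨ zerosBY≡ R ⟩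
          zeros BX R      ∎))
        (sym (bottomTarget-false j j<C))
      rgt : ∀ i → i < R → right X BX i ≡ (k <ᵇ rowLabel i)
      rgt i i<R =
        trans (cong₂ _∨_ (sym (rows i)) (cong₂ _<ᵇ_ (sym (zerosBY≡ i)) (sym onesY≡))) (right-id i i<R)

    viaRow : ∀ {i₀} → i₀ < R → BX i₀ ≡ false → BY i₀ ≡ true →
             (∀ i → i ≢ i₀ → BY i ≡ BX i) → (∀ c → c ≢ 0 → Y c ≡ X c) → IdentityAt k X BX
    viaRow {i₀} i₀<R BXi₀ BYi₀ rows cols = record { bottom-id = bot ; right-id = rgt }
      where
      onesX≡ : ∀ j → 0 < j → ones X j ≡ suc (ones Y j)
      onesX≡ = ones-flip-> (λ c c≢0 → sym (cols c c≢0)) Y0 X0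
      rows′ : ∀ i → i ≢ i₀ → not (BX i) ≡ not (BY i)
      rows′ i i≢i₀ = cong not (sym (rows i i≢i₀))
      zerosBX≡-≤ : ∀ i → i ≤ i₀ → zeros BX i ≡ zeros BY i
      zerosBX≡-≤ = ones-agree-≤ rows′
      zerosBX≡-> : ∀ i → i₀ < i → zeros BX i ≡ suc (zeros BY i)
      zerosBX≡-> = ones-flip-> rows′ (cong not BYi₀) (cong not BXi₀)
      bot : ∀ j → j < C → bottom X BX j ≡ (k <ᵇ suc j)
      bot j j<C = trans (bottom-false {X} {BX} {j} (begin
          ones X (suc j)        ≡⟨ onesX≡ (suc j) z<s ⟩
          suc (ones Y (suc j))  ≤⟨ s≤s (ones-mono Y j<C) ⟩
          suc (ones Y C)        ≤⟨ s≤s onesY≤zerosBY ⟩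
          suc (zeros BY R)      ≡⟨ zerosBX≡-> R i₀<R ⟨
          zeros BX R            ∎))
        (sym (bottomTarget-false j j<C))
      target-true : ∀ i → i ≤ i₀ → (k <ᵇ rowLabel i) ≡ true
      target-true = rowTarget-true i₀<R BYi₀
      zeros<ones : ∀ {i} → i < i₀ → BY i ≡ false → zeros BY i < ones Y C
      zeros<ones = zerosBY<onesY i₀<R BYi₀
      zerosBX<onesX : ∀ i → zeros BX i ≡ zeros BY i → zeros BY i ≤ ones Y C → zeros BX i < ones X C
      zerosBX<onesX i eq le = begin-strict
        zeros BX i      ≡⟨ eq ⟩
        zeros BY i      ≤⟨ le ⟩
        ones Y C        <⟨ n<1+n _ ⟩
        suc (ones Y C)  ≡⟨ onesX≡ C 1≤C ⟨
        ones X C        ∎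
      rgt : ∀ i → i < R → right X BX i ≡ (k <ᵇ rowLabel i)
      rgt i i<R with <-cmp i i₀
      ... | tri< i<i₀ _ _ = trans
            (right-true {X} {BX} {i} λ BXi → zerosBX<onesX i (zerosBX≡-≤ i (<⇒≤ i<i₀))
              (<⇒≤ (zeros<ones i<i₀ (trans (rows i (<⇒≢ i<i₀)) BXi))))
            (sym (target-true i (<⇒≤ i<i₀)))
      ... | tri≈ _ refl _ = trans
            (right-true {X} {BX} {i} λ _ → zerosBX<onesX i (zerosBX≡-≤ i ≤-refl)
              (right-true⇒zeros≤ones {Y} {BY} i λ i′ i′<i → right-true {Y} {BY} {i′} (zeros<ones i′<i)))
            (sym (target-true i ≤-refl))
      ... | tri> _ _ i₀<i = trans
            (cong₂ _∨_ (sym (rows i (>⇒≢ i₀<i))) (cong₂ _<ᵇ_ (zerosBX≡-> i i₀<i) (onesX≡ C 1≤C)))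
            (right-id i i<R)

  identityAt-moveCorner : ∀ {k X BX Y BY} → 1 ≤ k → k ≤ C → X 0 ≡ true → Y 0 ≡ false →
                          CornerMoved X BX Y BY → IdentityAt k X BX → IdentityAt k Y BY
  identityAt-moveCorner 1≤k k≤C X0 Y0 (toColumn 1≤p p<C Xp Yp cols rows) idX =
    SmallThreshold.viaColumn 1≤k k≤C X0 Y0 idX 1≤p p<C Xp Yp cols rows
  identityAt-moveCorner 1≤k k≤C X0 Y0 (toRow i₀<R BXi₀ BYi₀ rows cols) idX =
    SmallThreshold.viaRow 1≤k k≤C X0 Y0 idX i₀<R BXi₀ BYi₀ rows cols

  identityAt-restoreCorner : ∀ {k X BX Y BY} → 1 ≤ C → C ≤ k → X 0 ≡ true → Y 0 ≡ false →
                             CornerMoved X BX Y BY → IdentityAt k Y BY → IdentityAt k X BX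
  identityAt-restoreCorner 1≤C C≤k X0 Y0 (toColumn 1≤p p<C Xp Yp cols rows) idY =
    LargeThreshold.viaColumn 1≤C C≤k X0 Y0 idY 1≤p p<C Xp Yp cols rows
  identityAt-restoreCorner 1≤C C≤k X0 Y0 (toRow i₀<R BXi₀ BYi₀ rows cols) idY =
    LargeThreshold.viaRow 1≤C C≤k X0 Y0 idY i₀<R BXi₀ BYi₀ rows cols

⊖-+-cancel : ∀ a b d → (a ⊖ b) ℤ.+ ℤ.+ (b + d) ≡ ℤ.+ (a + d)
⊖-+-cancel a b d = begin
  (a ⊖ b) ℤ.+ ℤ.+ (b + d)  ≡⟨ ℤP.distribˡ-⊖-+-pos (b + d) a b ⟩
  (a + (b + d)) ⊖ b        ≡⟨ cong₂ _⊖_ a+[b+d]≡b+[a+d] (sym (+-identityʳ b)) ⟩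
  (b + (a + d)) ⊖ (b + 0)  ≡⟨ ℤP.+-cancelˡ-⊖ b (a + d) 0 ⟩
  (a + d) ⊖ 0              ≡⟨ ℤP.⊖-≥ z≤n ⟩
  ℤ.+ (a + d)              ∎
  where
  open ≡-Reasoning
  a+[b+d]≡b+[a+d] : a + (b + d) ≡ b + (a + d)
  a+[b+d]≡b+[a+d] = trans (sym (+-assoc a b d)) (trans (cong (_+ d) (+-comm a b)) (+-assoc b a d))

⊖≡⊖⇒+≡+ : ∀ a b c d → a ⊖ b ≡ c ⊖ d → a + d ≡ c + b
⊖≡⊖⇒+≡+ a b c d e = ℤP.+-injective (begin
  ℤ.+ (a + d)              ≡⟨ ⊖-+-cancel a b d ⟨
  (a ⊖ b) ℤ.+ ℤ.+ (b + d)  ≡⟨ cong₂ ℤ._+_ e (cong ℤ.+_ (+-comm b d)) ⟩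
  (c ⊖ d) ℤ.+ ℤ.+ (d + b)  ≡⟨ ⊖-+-cancel c d b ⟩
  ℤ.+ (c + b)              ∎)
  where open ≡-Reasoning

+≡+⇒⊖≡⊖ : ∀ a b c d → a + d ≡ c + b → a ⊖ b ≡ c ⊖ d
+≡+⇒⊖≡⊖ a b c d e = begin
  a ⊖ b              ≡⟨ ℤP.+-cancelˡ-⊖ d a b ⟨
  (d + a) ⊖ (d + b)  ≡⟨ cong₂ _⊖_ (trans (+-comm d a) (trans e (+-comm c b))) (+-comm d b) ⟩
  (b + c) ⊖ (b + d)  ≡⟨ ℤP.+-cancelˡ-⊖ b c d ⟩
  c ⊖ d              ∎
  where open ≡-Reasoning

⊖-pred : ∀ j i → (j ⊖ i) ℤ.- ℤ.1ℤ ≡ j ⊖ suc i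
⊖-pred j i = trans (ℤP.distribˡ-⊖-+-neg 0 j i) (cong (j ⊖_) (cong suc (+-identityʳ i)))

⊖-suc : ∀ j i → (j ⊖ i) ℤ.+ ℤ.1ℤ ≡ suc j ⊖ i
⊖-suc j i = trans (ℤP.distribˡ-⊖-+-pos 1 j i) (cong (_⊖ i) (+-comm j 1))

∸-suc-< : ∀ {R a} → a < R → R ∸ suc a < R
∸-suc-< {suc R} {a} _ = s≤s (m∸n≤m R a)

∸-suc-involutive : ∀ {R i} → i < R → R ∸ suc (R ∸ suc i) ≡ i
∸-suc-involutive {suc R} (s≤s i≤R) = m∸[m∸n]≡n i≤R

update : (ℕ → ℕ) → ℕ → ℕ → ℕ → ℕ
update f a v b with b ≟ a
... | yes _ = v
... | no  _ = f b

update-≡ : ∀ f a v → update f a v a ≡ v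
update-≡ f a v with a ≟ a
... | yes _   = refl
... | no  a≢a = contradiction refl a≢a

update-≢ : ∀ f a v {b} → b ≢ a → update f a v b ≡ f b
update-≢ f a v {b} b≢a with b ≟ a
... | yes b≡a = contradiction b≡a b≢a
... | no  _   = refl

applyUpTo-cong : ∀ {A : Set} (F G : ℕ → A) N → (∀ b → b < N → F b ≡ G b) →
                 applyUpTo F N ≡ applyUpTo G N
applyUpTo-cong F G zero    _   = refl
applyUpTo-cong F G (suc N) F≗G =
  cong₂ _∷_ (F≗G 0 z<s) (applyUpTo-cong (F ∘ suc) (G ∘ suc) N λ b b<N → F≗G (suc b) (s≤s b<N))

applyUpTo-injective : ∀ {A : Set} (F G : ℕ → A) N → applyUpTo F N ≡ applyUpTo G N →
                      ∀ b → b < N → F b ≡ G b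
applyUpTo-injective F G (suc N) e zero    _         = proj₁ (∷-injective e)
applyUpTo-injective F G (suc N) e (suc b) (s≤s b<N) =
  applyUpTo-injective (F ∘ suc) (G ∘ suc) N (proj₂ (∷-injective e)) b b<N

applyUpTo-++ : ∀ {A : Set} (f : ℕ → A) m n →
               applyUpTo f (m + n) ≡ applyUpTo f m ++ applyUpTo (f ∘ (m +_)) n
applyUpTo-++ f zero    n = refl
applyUpTo-++ f (suc m) n = cong (f 0 ∷_) (applyUpTo-++ (f ∘ suc) m n)

tabulate≡applyUpTo : ∀ {A : Set} {n} (f : Fin n → A) (F : ℕ → A) → (∀ i → f i ≡ F (toℕ i)) →
                     tabulate f ≡ applyUpTo F n
tabulate≡applyUpTo {n = zero}  f F f≗F = refl
tabulate≡applyUpTo {n = suc n} f F f≗F =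
  cong₂ _∷_ (f≗F Fin.zero) (tabulate≡applyUpTo (f ∘ Fin.suc) (F ∘ suc) (f≗F ∘ Fin.suc))

applyUpTo-extract : ∀ {A : Set} (F F′ : ℕ → A) N a → a < N →
                    (∀ b → b < N → b ≢ a → F′ b ≡ F b) →
                    Σ (List A) λ X → (applyUpTo F N ↭ F a ∷ X) × (applyUpTo F′ N ↭ F′ a ∷ X)
applyUpTo-extract F F′ (suc N) zero _ agree =
  applyUpTo (F ∘ suc) N , ↭-refl ,
  prep (F′ 0) (↭-reflexive (applyUpTo-cong (F′ ∘ suc) (F ∘ suc) N λ b b<N →
    agree (suc b) (s≤s b<N) λ ()))
applyUpTo-extract F F′ (suc N) (suc a) (s≤s a<N) agree
  with applyUpTo-extract (F ∘ suc) (F′ ∘ suc) N a a<N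
         (λ b b<N b≢a → agree (suc b) (s≤s b<N) (b≢a ∘ suc-injective))
... | X , p , p′ =
  F 0 ∷ X ,
  ↭-trans (prep (F 0) p) (swap (F 0) (F (suc a)) ↭-refl) ,
  ↭-trans (prep (F′ 0) p′) (↭-trans (swap (F′ 0) (F′ (suc a)) ↭-refl)
    (↭-reflexive (cong (λ z → F′ (suc a) ∷ z ∷ X) (agree 0 z<s λ ()))))

AllPairs-resp-↭ : ∀ {A : Set} {P : A → A → Set} → Symmetric P →
                  ∀ {xs ys} → xs ↭ ys → AllPairs P xs → AllPairs P ys
AllPairs-resp-↭ {A} {P} sym p = Permutationₛ.AllPairs-resp-↭ (setoid A) sym (resp₂ P) (↭⇒↭ₛ p)

AllPairs-↭-unique : ∀ {A : Set} {P : A → A → Set} → (∀ {x y} → P x y → ¬ P y x) →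
                    ∀ {xs ys} → xs ↭ ys → AllPairs P xs → AllPairs P ys → xs ≡ ys
AllPairs-↭-unique asym {[]}     p _ _ = sym (↭-empty-inv (↭-sym p))
AllPairs-↭-unique asym {x ∷ xs} {[]} p _ _ = contradiction p ¬x∷xs↭[]
AllPairs-↭-unique asym {x ∷ xs} {y ∷ ys} p (x< ∷ xs<) (y< ∷ ys<) =
  heads (∈-resp-↭ p (here refl)) (∈-resp-↭ (↭-sym p) (here refl))
  where
  same : x ≡ y → x ∷ xs ≡ y ∷ ys
  same refl = cong (x ∷_) (AllPairs-↭-unique asym (drop-∷ p) xs< ys<)
  heads : x ∈ y ∷ ys → y ∈ x ∷ xs → x ∷ xs ≡ y ∷ ys
  heads (here x≡y)   _              = same x≡y
  heads (there _)    (here y≡x)     = same (sym y≡x)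
  heads (there x∈ys) (there y∈xs)   = contradiction (All.lookup y< x∈ys) (asym (All.lookup x< y∈xs))

Linked-zip⁺ : ∀ {A B : Set} {P : A → A → Set} {ps : List A} {ls : List B} →
              Linked P ps → Linked (λ x y → P (proj₁ x) (proj₁ y)) (zip ps ls)
Linked-zip⁺ {ps = []}                     []       = []
Linked-zip⁺ {ps = p ∷ []}     {[]}        [-]      = []
Linked-zip⁺ {ps = p ∷ []}     {l ∷ ls}    [-]      = [-]
Linked-zip⁺ {ps = p ∷ q ∷ ps} {[]}        (_ ∷ _)  = []
Linked-zip⁺ {ps = p ∷ q ∷ ps} {l ∷ []}    (_ ∷ _)  = [-]
Linked-zip⁺ {ps = p ∷ q ∷ ps} {l ∷ m ∷ ls} (p<q ∷ rest) =
  p<q ∷ Linked-zip⁺ {ps = q ∷ ps} {m ∷ ls} rest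

map-proj₂-zip : ∀ {A B : Set} (ps : List A) (ls : List B) → length ps ≡ length ls →
                map proj₂ (zip ps ls) ≡ ls
map-proj₂-zip []       []       _ = refl
map-proj₂-zip (p ∷ ps) (l ∷ ls) e = cong (l ∷_) (map-proj₂-zip ps ls (suc-injective e))

zip-map-proj : ∀ {A B : Set} (xs : List (A × B)) → zip (map proj₁ xs) (map proj₂ xs) ≡ xs
zip-map-proj []       = refl
zip-map-proj (x ∷ xs) = cong (x ∷_) (zip-map-proj xs)

<-pair⇒⊓⊔ : ∀ {a b α β} → α < β → (α ≡ a × β ≡ b) ⊎ (α ≡ b × β ≡ a) →
            α ≡ a ⊓ b × β ≡ a ⊔ b
<-pair⇒⊓⊔ α<β (inj₁ (refl , refl)) =
  sym (m≤n⇒m⊓n≡m (<⇒≤ α<β)) , sym (m≤n⇒m⊔n≡n (<⇒≤ α<β))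
<-pair⇒⊓⊔ α<β (inj₂ (refl , refl)) =
  sym (m≥n⇒m⊓n≡n (<⇒≤ α<β)) , sym (m≥n⇒m⊔n≡m (<⇒≤ α<β))

-- Toppling runs the comparator grid

module Toppling (T L : ℕ → ℕ) (R C : ℕ) where

  colChip : (ℕ → ℕ) → ℕ → Chip
  colChip h j = (j ⊖ h j , col T L (h j) j)

  rowChip : (ℕ → ℕ) → ℕ → Chip
  rowChip g i = (g i ⊖ i , row T L i (g i))

  mirror : ℕ → ℕ
  mirror a = R ∸ suc a

  -- Rows are listed bottom-up so that the configuration of the complete cut is sorted by position.
  cutConfig : (ℕ → ℕ) → (ℕ → ℕ) → Config
  cutConfig h g = applyUpTo (colChip h) C ++ applyUpTo (rowChip g ∘ mirror) R

  -- Column j has crossed rows 0 … h j - 1 and row i has crossed columns 0 … g i - 1.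
  record Cut (h g : ℕ → ℕ) : Set where
    field
      col⇒row : ∀ i j → i < R → j < C → i < h j → j < g i
      row⇒col : ∀ i j → i < R → j < C → j < g i → i < h j
      h≤R     : ∀ j → j < C → h j ≤ R
      g≤C     : ∀ i → i < R → g i ≤ C

  record Ready (h g : ℕ → ℕ) (i j : ℕ) : Set where
    field
      i<R  : i < R
      j<C  : j < C
      hj≡i : h j ≡ i
      gi≡j : g i ≡ j

  module _ {h g : ℕ → ℕ} (cut : Cut h g) where
    open Cut cut

    h-antitone : ∀ {j j′} → j < j′ → j′ < C → h j′ ≤ h j
    h-antitone {j} {j′} j<j′ j′<C = ≮⇒≥ λ hj<hj′ →
      let hj<R = <-≤-trans hj<hj′ (h≤R j′ j′<C) in
      <-irrefl refl (row⇒col (h j) j hj<R (<-trans j<j′ j′<C)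
                              (<-trans j<j′ (col⇒row (h j) j′ hj<R j′<C hj<hj′)))

    g-antitone : ∀ {i i′} → i < i′ → i′ < R → g i′ ≤ g i
    g-antitone {i} {i′} i<i′ i′<R = ≮⇒≥ λ gi<gi′ →
      let gi<C = <-≤-trans gi<gi′ (g≤C i′ i′<R) in
      <-irrefl refl (col⇒row i (g i) (<-trans i<i′ i′<R) gi<C
                              (<-trans i<i′ (row⇒col i′ (g i) i′<R gi<C gi<gi′)))

    colPos-injective : ∀ {j j′} → j < C → j′ < C → j ⊖ h j ≡ j′ ⊖ h j′ → j ≡ j′
    colPos-injective {j} {j′} j<C j′<C e with ⊖≡⊖⇒+≡+ j (h j) j′ (h j′) e | <-cmp j j′
    ... | _ | tri≈ _ j≡j′ _ = j≡j′
    ... | e′ | tri< j<j′ _ _ = contradiction e′ (<⇒≢ (+-mono-<-≤ j<j′ (h-antitone j<j′ j′<C)))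
    ... | e′ | tri> _ _ j′<j = contradiction (sym e′) (<⇒≢ (+-mono-<-≤ j′<j (h-antitone j′<j j<C)))

    rowPos-injective : ∀ {i i′} → i < R → i′ < R → g i ⊖ i ≡ g i′ ⊖ i′ → i ≡ i′
    rowPos-injective {i} {i′} i<R i′<R e with ⊖≡⊖⇒+≡+ (g i) i (g i′) i′ e | <-cmp i i′
    ... | _ | tri≈ _ i≡i′ _ = i≡i′
    ... | e′ | tri< i<i′ _ _ = contradiction (sym e′) (<⇒≢ (+-mono-≤-< (g-antitone i<i′ i′<R) i<i′))
    ... | e′ | tri> _ _ i′<i = contradiction e′ (<⇒≢ (+-mono-≤-< (g-antitone i′<i i<R) i′<i))

    samePos⇒Ready : ∀ {i j} → i < R → j < C → j ⊖ h j ≡ g i ⊖ i → Ready h g i j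
    samePos⇒Ready {i} {j} i<R j<C e with ⊖≡⊖⇒+≡+ j (h j) (g i) i e | <-cmp i (h j)
    ... | e′ | tri< i<hj _ _ = contradiction e′ (<⇒≢ (+-mono-< (col⇒row i j i<R j<C i<hj) i<hj))
    ... | e′ | tri> _ _ hj<i = contradiction (sym e′)
          (<⇒≢ (+-mono-≤-< (≮⇒≥ λ j<gi → <-asym hj<i (row⇒col i j i<R j<C j<gi)) hj<i))
    ... | e′ | tri≈ _ i≡hj _ = record
      { i<R = i<R ; j<C = j<C ; hj≡i = sym i≡hj
      ; gi≡j = sym (+-cancelʳ-≡ i j (g i) (trans e′ (cong (g i +_) (sym i≡hj)))) }

  IsCutConfig : Config → Set
  IsCutConfig c = Σ (ℕ → ℕ) λ h → Σ (ℕ → ℕ) λ g → Cut h g × (c ↭ cutConfig h g)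

  module Fire {h g : ℕ → ℕ} {i j : ℕ} (cut : Cut h g) (ready : Ready h g i j) where
    open Cut cut
    open Ready ready

    h′ : ℕ → ℕ
    h′ = update h j (suc i)

    g′ : ℕ → ℕ
    g′ = update g i (suc j)

    cut′ : Cut h′ g′
    cut′ = record { col⇒row = col⇒row′ ; row⇒col = row⇒col′ ; h≤R = h′≤R ; g≤C = g′≤C }
      where
      col⇒row′ : ∀ i₁ j₁ → i₁ < R → j₁ < C → i₁ < h′ j₁ → j₁ < g′ i₁
      col⇒row′ i₁ j₁ i₁<R j₁<C lt with j₁ ≟ j | i₁ ≟ i
      ... | yes refl | yes refl = n<1+n j
      ... | yes refl | no i₁≢i =
            col⇒row i₁ j₁ i₁<R j₁<C (subst (i₁ <_) (sym hj≡i) (≤∧≢⇒< (s≤s⁻¹ lt) i₁≢i))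
      ... | no j₁≢j | yes refl =
            subst (λ z → j₁ < suc z) gi≡j (m<n⇒m<1+n (col⇒row i₁ j₁ i₁<R j₁<C lt))
      ... | no j₁≢j | no i₁≢i =
            col⇒row i₁ j₁ i₁<R j₁<C lt
      row⇒col′ : ∀ i₁ j₁ → i₁ < R → j₁ < C → j₁ < g′ i₁ → i₁ < h′ j₁
      row⇒col′ i₁ j₁ i₁<R j₁<C lt with j₁ ≟ j | i₁ ≟ i
      ... | yes refl | yes refl = n<1+n i
      ... | yes refl | no i₁≢i =
            subst (λ z → i₁ < suc z) hj≡i (m<n⇒m<1+n (row⇒col i₁ j₁ i₁<R j₁<C lt))
      ... | no j₁≢j | yes refl =
            row⇒col i₁ j₁ i₁<R j₁<C (subst (j₁ <_) (sym gi≡j) (≤∧≢⇒< (s≤s⁻¹ lt) j₁≢j))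
      ... | no j₁≢j | no i₁≢i =
            row⇒col i₁ j₁ i₁<R j₁<C lt
      h′≤R : ∀ j₁ → j₁ < C → h′ j₁ ≤ R
      h′≤R j₁ j₁<C with j₁ ≟ j
      ... | yes refl = i<R
      ... | no j₁≢j = h≤R j₁ j₁<C
      g′≤C : ∀ i₁ → i₁ < R → g′ i₁ ≤ C
      g′≤C i₁ i₁<R with i₁ ≟ i
      ... | yes refl = j<C
      ... | no i₁≢i = g≤C i₁ i₁<R

    split : Σ Config λ X → (cutConfig h g ↭ colChip h j ∷ rowChip g i ∷ X)
                         × (cutConfig h′ g′ ↭ colChip h′ j ∷ rowChip g′ i ∷ X)
    split with applyUpTo-extract (colChip h) (colChip h′) C j j<C
                 (λ b _ b≢j → cong (λ z → (b ⊖ z , col T L z b)) (update-≢ h j (suc i) b≢j))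
             | applyUpTo-extract (rowChip g ∘ mirror) (rowChip g′ ∘ mirror) R (mirror i) (∸-suc-< i<R)
                 (λ b b<R b≢ → cong (λ z → (z ⊖ mirror b , row T L (mirror b) z))
                   (update-≢ g i (suc j) λ e → b≢ (trans (sym (∸-suc-involutive b<R)) (cong mirror e))))
    ... | Xc , pc , pc′ | Xr , pr , pr′ =
      Xc ++ Xr , ↭-trans (++⁺ pc (unmirror g pr)) (prep _ (shift _ Xc Xr))
               , ↭-trans (++⁺ pc′ (unmirror g′ pr′)) (prep _ (shift _ Xc Xr))
      where
      unmirror : ∀ g {xs} → xs ↭ rowChip g (mirror (mirror i)) ∷ Xr → xs ↭ rowChip g i ∷ Xr
      unmirror g {xs} = subst (λ z → xs ↭ rowChip g z ∷ Xr) (∸-suc-involutive i<R)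

    ready-colChip : colChip h j ≡ (j ⊖ i , col T L i j)
    ready-colChip = cong (λ z → (j ⊖ z , col T L z j)) hj≡i

    ready-rowChip : rowChip g i ≡ (j ⊖ i , row T L i j)
    ready-rowChip = cong (λ z → (z ⊖ i , row T L i z)) gi≡j

    CellChips : ℤ → ℕ → ℕ → Set
    CellChips x α β = ((x , α) ≡ colChip h j × (x , β) ≡ rowChip g i)
                    ⊎ ((x , α) ≡ rowChip g i × (x , β) ≡ colChip h j)

    cellChips-aligned : ∀ {rest x α β} → cutConfig h g ↭ (x , α) ∷ (x , β) ∷ rest →
                        CellChips x α β → cutConfig h g ↭ colChip h j ∷ rowChip g i ∷ rest
    cellChips-aligned {rest} p (inj₁ (e₁ , e₂)) = subst₂ (λ u v → _ ↭ u ∷ v ∷ rest) e₁ e₂ p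
    cellChips-aligned {rest} p (inj₂ (e₁ , e₂)) =
      subst₂ (λ u v → _ ↭ v ∷ u ∷ rest) e₁ e₂ (↭-trans p (swap _ _ ↭-refl))

    cellChips-position : ∀ {x α β} → CellChips x α β → x ≡ j ⊖ i
    cellChips-position (inj₁ (e₁ , _)) = cong proj₁ (trans e₁ ready-colChip)
    cellChips-position (inj₂ (_ , e₂)) = cong proj₁ (trans e₂ ready-colChip)

    cellChips-labels : ∀ {x α β} → CellChips x α β →
                       (α ≡ col T L i j × β ≡ row T L i j) ⊎ (α ≡ row T L i j × β ≡ col T L i j)
    cellChips-labels (inj₁ (e₁ , e₂)) =
      inj₁ (cong proj₂ (trans e₁ ready-colChip) , cong proj₂ (trans e₂ ready-rowChip))
    cellChips-labels (inj₂ (e₁ , e₂)) =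
      inj₂ (cong proj₂ (trans e₁ ready-rowChip) , cong proj₂ (trans e₂ ready-colChip))

    fire-move : ∀ {rest x α β} → cutConfig h g ↭ (x , α) ∷ (x , β) ∷ rest → α < β →
                CellChips x α β → (x ℤ.- ℤ.1ℤ , α) ∷ (x ℤ.+ ℤ.1ℤ , β) ∷ rest ↭ cutConfig h′ g′
    fire-move {rest} {x} {α} {β} p α<β chips =
      ↭-trans (prep _ (prep _ rest↭X))
        (↭-trans (↭-reflexive (cong₂ (λ u v → u ∷ v ∷ X) fired-col fired-row))
                 (↭-sym (proj₂ (proj₂ split))))
      where
      X : Config
      X = proj₁ split
      rest↭X : rest ↭ X
      rest↭X = drop-∷ (drop-∷ (↭-trans (↭-sym (cellChips-aligned p chips)) (proj₁ (proj₂ split))))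
      x≡ : x ≡ j ⊖ i
      x≡ = cellChips-position chips
      α≡,β≡ : α ≡ col T L i j ⊓ row T L i j × β ≡ col T L i j ⊔ row T L i j
      α≡,β≡ = <-pair⇒⊓⊔ α<β (cellChips-labels chips)
      fired-col : (x ℤ.- ℤ.1ℤ , α) ≡ colChip h′ j
      fired-col rewrite update-≡ h j (suc i) =
        cong₂ _,_ (trans (cong (ℤ._- ℤ.1ℤ) x≡) (⊖-pred j i)) (proj₁ α≡,β≡)
      fired-row : (x ℤ.+ ℤ.1ℤ , β) ≡ rowChip g′ i
      fired-row rewrite update-≡ g i (suc j) =
        cong₂ _,_ (trans (cong (ℤ._+ ℤ.1ℤ) x≡) (⊖-suc j i)) (proj₂ α≡,β≡)

    fire-cutConfig : ∀ {rest x α β} → cutConfig h g ↭ (x , α) ∷ (x , β) ∷ rest → α < β →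
                     CellChips x α β → IsCutConfig ((x ℤ.- ℤ.1ℤ , α) ∷ (x ℤ.+ ℤ.1ℤ , β) ∷ rest)
    fire-cutConfig p α<β chips = h′ , g′ , cut′ , fire-move p α<β chips

  ∈-cutConfig : ∀ {h g y} → y ∈ cutConfig h g →
                (Σ ℕ λ j → j < C × y ≡ colChip h j) ⊎ (Σ ℕ λ a → a < R × y ≡ rowChip g (mirror a))
  ∈-cutConfig {h} {g} y∈ with ∈-++⁻ (applyUpTo (colChip h) C) y∈
  ... | inj₁ y∈cols = inj₁ (∈-applyUpTo⁻ (colChip h) y∈cols)
  ... | inj₂ y∈rows = inj₂ (∈-applyUpTo⁻ (rowChip g ∘ mirror) y∈rows)

  -- Two chips at the same position are a column and a row that meet at a ready cell,
  -- and the move fires that cell.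
  move-preserves-cut : ∀ {h g rest x α β} → Cut h g → cutConfig h g ↭ (x , α) ∷ (x , β) ∷ rest →
                       α < β → IsCutConfig ((x ℤ.- ℤ.1ℤ , α) ∷ (x ℤ.+ ℤ.1ℤ , β) ∷ rest)
  move-preserves-cut {h} {g} {rest} {x} {α} {β} cut p α<β
    with ∈-cutConfig {h} {g} (∈-resp-↭ (↭-sym p) (here refl))
       | ∈-cutConfig {h} {g} (∈-resp-↭ (↭-sym p) (there (here refl)))
  ... | inj₁ (j₁ , j₁<C , e₁) | inj₁ (j₂ , j₂<C , e₂) = contradiction α≡β (<⇒≢ α<β)
    where
    j₁≡j₂ : j₁ ≡ j₂
    j₁≡j₂ = colPos-injective cut j₁<C j₂<C (trans (sym (cong proj₁ e₁)) (cong proj₁ e₂))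
    α≡β : α ≡ β
    α≡β = trans (cong proj₂ e₁) (trans (cong (λ z → col T L (h z) z) j₁≡j₂) (sym (cong proj₂ e₂)))
  ... | inj₂ (a₁ , a₁<R , e₁) | inj₂ (a₂ , a₂<R , e₂) = contradiction α≡β (<⇒≢ α<β)
    where
    i₁≡i₂ : mirror a₁ ≡ mirror a₂
    i₁≡i₂ = rowPos-injective cut (∸-suc-< a₁<R) (∸-suc-< a₂<R)
                             (trans (sym (cong proj₁ e₁)) (cong proj₁ e₂))
    α≡β : α ≡ β
    α≡β = trans (cong proj₂ e₁) (trans (cong (λ z → row T L z (g z)) i₁≡i₂) (sym (cong proj₂ e₂)))
  ... | inj₁ (j , j<C , e₁) | inj₂ (a , a<R , e₂) =
    Fire.fire-cutConfig cut
      (samePos⇒Ready cut (∸-suc-< a<R) j<C (trans (sym (cong proj₁ e₁)) (cong proj₁ e₂)))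
      p α<β (inj₁ (e₁ , e₂))
  ... | inj₂ (a , a<R , e₁) | inj₁ (j , j<C , e₂) =
    Fire.fire-cutConfig cut
      (samePos⇒Ready cut (∸-suc-< a<R) j<C (trans (sym (cong proj₁ e₂)) (cong proj₁ e₁)))
      p α<β (inj₂ (e₁ , e₂))

  reachable⇒cutConfig : ∀ {h g c c′} → Cut h g → c ↭ cutConfig h g → c ⟶* c′ → IsCutConfig c′
  reachable⇒cutConfig cut c↭ ε = _ , _ , cut , c↭
  reachable⇒cutConfig cut c↭ (move p α<β ◅ moves)
    with move-preserves-cut cut (↭-trans (↭-sym c↭) p) α<β
  ... | _ , _ , cut′ , c′↭ = reachable⇒cutConfig cut′ c′↭ moves

  -- Row h j waits for column g (h j) ≤ j; following these waits strictly decreases the column.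
  ready-cell : ∀ {h g} → Cut h g → ∀ fuel j → j < fuel → j < C → h j < R →
               Σ ℕ λ i → Σ ℕ λ j′ → Ready h g i j′
  ready-cell {h} {g} cut (suc fuel) j (s≤s j<fuel) j<C hj<R with <-cmp (g (h j)) j
  ... | tri≈ _ e _ = h j , j , record { i<R = hj<R ; j<C = j<C ; hj≡i = refl ; gi≡j = e }
  ... | tri> _ _ j<ghj = contradiction (Cut.row⇒col cut (h j) j hj<R j<C j<ghj) (<-irrefl refl)
  ... | tri< ghj<j _ _ = ready-cell cut fuel (g (h j)) (<-≤-trans ghj<j j<fuel) (<-trans ghj<j j<C)
        (≤-<-trans (≮⇒≥ λ hj<h′ → <-irrefl refl
          (Cut.col⇒row cut (h j) (g (h j)) hj<R (<-trans ghj<j j<C) hj<h′)) hj<R)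

  stable⇒complete : ∀ {h g c} → Cut h g → c ↭ cutConfig h g → Stable c → ∀ j → j < C → h j ≡ R
  stable⇒complete {h} {g} cut c↭ stable j j<C with m≤n⇒m<n∨m≡n (Cut.h≤R cut j j<C)
  ... | inj₂ hj≡R = hj≡R
  ... | inj₁ hj<R with ready-cell cut (suc j) j ≤-refl j<C hj<R
  ...   | i , j′ , ready
          with AllPairs-resp-↭ ≢-sym (↭-trans c↭ (proj₁ (proj₂ (Fire.split cut ready)))) stable
  ...     | (pos≢ ∷ _) ∷ _ = contradiction
    (trans (cong proj₁ (Fire.ready-colChip cut ready)) (sym (cong proj₁ (Fire.ready-rowChip cut ready)))) pos≢

  fullConfig : Config
  fullConfig = cutConfig (λ _ → R) (λ _ → C)

  complete⇒fullConfig : ∀ {h g} → Cut h g → (∀ j → j < C → h j ≡ R) → cutConfig h g ≡ fullConfig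
  complete⇒fullConfig {h} {g} cut complete = cong₂ _++_
    (applyUpTo-cong (colChip h) (colChip (λ _ → R)) C λ j j<C →
      cong (λ z → (j ⊖ z , col T L z j)) (complete j j<C))
    (applyUpTo-cong (rowChip g ∘ mirror) (rowChip (λ _ → C) ∘ mirror) R λ a a<R →
      cong (λ z → (z ⊖ mirror a , row T L (mirror a) z)) (rows-complete (mirror a) (∸-suc-< a<R)))
    where
    rows-complete : ∀ i → i < R → g i ≡ C
    rows-complete i i<R with m≤n⇒m<n∨m≡n (Cut.g≤C cut i i<R)
    ... | inj₂ gi≡C = gi≡C
    ... | inj₁ gi<C = contradiction
      (Cut.col⇒row cut i (g i) i<R gi<C (subst (i <_) (sym (complete (g i) gi<C)) i<R)) (<-irrefl refl)

  unfired : (ℕ → ℕ) → ℕ → ℕ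
  unfired h zero    = 0
  unfired h (suc c) = (R ∸ h c) + unfired h c

  unfired-cong : ∀ {h h′} N → (∀ c → c < N → h′ c ≡ h c) → unfired h′ N ≡ unfired h N
  unfired-cong zero    _    = refl
  unfired-cong (suc N) h′≗h =
    cong₂ _+_ (cong (R ∸_) (h′≗h N ≤-refl)) (unfired-cong N λ c c<N → h′≗h c (m<n⇒m<1+n c<N))

  unfired-update : ∀ h j N → j < N → h j < R → suc (unfired (update h j (suc (h j))) N) ≡ unfired h N
  unfired-update h j (suc N) (s≤s j≤N) hj<R with m≤n⇒m<n∨m≡n j≤N
  ... | inj₂ refl = begin
      suc ((R ∸ update h j (suc (h j)) j) + unfired (update h j (suc (h j))) j)
        ≡⟨ cong₂ (λ u v → suc ((R ∸ u) + v)) (update-≡ h j (suc (h j)))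
                 (unfired-cong j λ c c<j → update-≢ h j (suc (h j)) (<⇒≢ c<j)) ⟩
      suc ((R ∸ suc (h j)) + unfired h j)
        ≡⟨ cong (_+ unfired h j) (sym (+-∸-assoc 1 hj<R)) ⟩
      (R ∸ h j) + unfired h j ∎
    where open ≡-Reasoning
  ... | inj₁ j<N = begin
      suc ((R ∸ update h j (suc (h j)) N) + unfired (update h j (suc (h j))) N)
        ≡⟨ cong (λ u → suc ((R ∸ u) + unfired (update h j (suc (h j))) N))
                (update-≢ h j (suc (h j)) (>⇒≢ j<N)) ⟩
      suc ((R ∸ h N) + unfired (update h j (suc (h j))) N)
        ≡⟨ sym (+-suc (R ∸ h N) _) ⟩
      (R ∸ h N) + suc (unfired (update h j (suc (h j))) N)
        ≡⟨ cong ((R ∸ h N) +_) (unfired-update h j N j<N hj<R) ⟩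
      (R ∸ h N) + unfired h N ∎
    where open ≡-Reasoning

  unfired-fire : ∀ {h g i j} (cut : Cut h g) (ready : Ready h g i j) →
                 suc (unfired (Fire.h′ cut ready) C) ≡ unfired h C
  unfired-fire {h} {i = i} {j} cut ready =
    subst (λ z → suc (unfired (update h j (suc z)) C) ≡ unfired h C) hj≡i
      (unfired-update h j C j<C (subst (_< R) (sym hj≡i) i<R))
    where open Ready ready

  unfired-suc⇒incomplete : ∀ h N f → unfired h N ≡ suc f → Σ ℕ λ j → j < N × h j < R
  unfired-suc⇒incomplete h (suc N) f e with R ∸ h N in eq
  ... | suc _ = N , ≤-refl , m∸n≢0⇒n<m λ eq′ → contradiction (trans (sym eq) eq′) λ ()
  ... | zero with unfired-suc⇒incomplete h N f e
  ...   | j , j<N , hj<R = j , m<n⇒m<1+n j<N , hj<R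

  unfired-zero⇒complete : ∀ h N → unfired h N ≡ 0 → ∀ j → j < N → R ≤ h j
  unfired-zero⇒complete h (suc N) e j (s≤s j≤N) with m≤n⇒m<n∨m≡n j≤N
  ... | inj₂ refl = m∸n≡0⇒m≤n (m+n≡0⇒m≡0 (R ∸ h j) e)
  ... | inj₁ j<N  = unfired-zero⇒complete h N (m+n≡0⇒n≡0 (R ∸ h N) e) j j<N

  DistinctLabels : Config → Set
  DistinctLabels = AllPairs λ x y → proj₂ x ≢ proj₂ y

  distinctLabels-move : ∀ {x y z α β rest} → DistinctLabels ((x , α) ∷ (x , β) ∷ rest) →
                        DistinctLabels ((y , α) ∷ (z , β) ∷ rest)
  distinctLabels-move ((α≢β ∷ α∉) ∷ β∉ ∷ distinct) = (α≢β ∷ α∉) ∷ β∉ ∷ distinct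

  fire-step : ∀ {h g i j c} (cut : Cut h g) (ready : Ready h g i j) →
              DistinctLabels c → c ↭ cutConfig h g →
              Σ Config λ c′ → c ⟶ c′ × DistinctLabels c′
                            × c′ ↭ cutConfig (Fire.h′ cut ready) (Fire.g′ cut ready)
  fire-step {h} {g} {i} {j} {c} cut ready distinct c↭ = fire-smaller-left (<-cmp t l)
    where
    open Fire cut ready
    t l : ℕ
    t = col T L i j
    l = row T L i j
    X : Config
    X = proj₁ split
    q : c ↭ (j ⊖ i , t) ∷ (j ⊖ i , l) ∷ X
    q = subst₂ (λ u v → c ↭ u ∷ v ∷ X) ready-colChip ready-rowChip
               (↭-trans c↭ (proj₁ (proj₂ split)))
    q′ : c ↭ (j ⊖ i , l) ∷ (j ⊖ i , t) ∷ X
    q′ = ↭-trans q (swap _ _ ↭-refl)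
    fire-smaller-left : Tri (t < l) (t ≡ l) (l < t) →
                        Σ Config λ c′ → c ⟶ c′ × DistinctLabels c′ × c′ ↭ cutConfig h′ g′
    fire-smaller-left (tri< t<l _ _) =
      _ , move q t<l , distinctLabels-move (AllPairs-resp-↭ ≢-sym q distinct) ,
      fire-move (↭-trans (↭-sym c↭) q) t<l (inj₁ (sym ready-colChip , sym ready-rowChip))
    fire-smaller-left (tri> _ _ l<t) =
      _ , move q′ l<t , distinctLabels-move (AllPairs-resp-↭ ≢-sym q′ distinct) ,
      fire-move (↭-trans (↭-sym c↭) q′) l<t (inj₂ (sym ready-rowChip , sym ready-colChip))
    fire-smaller-left (tri≈ _ t≡l _) with AllPairs-resp-↭ ≢-sym q distinct
    ... | (t≢l ∷ _) ∷ _ = contradiction t≡l t≢l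

  topple-to-full : ∀ fuel {h g c} → unfired h C ≡ fuel → Cut h g → DistinctLabels c →
                   c ↭ cutConfig h g → Σ Config λ c′ → c ⟶* c′ × c′ ↭ fullConfig
  topple-to-full zero {h} {g} {c} e cut _ c↭ =
    c , ε , subst (c ↭_) (complete⇒fullConfig cut λ j j<C →
      ≤-antisym (Cut.h≤R cut j j<C) (unfired-zero⇒complete h C e j j<C)) c↭
  topple-to-full (suc fuel) {h} e cut distinct c↭ with unfired-suc⇒incomplete h C fuel e
  ... | j₀ , j₀<C , hj₀<R with ready-cell cut (suc j₀) j₀ ≤-refl j₀<C hj₀<R
  ...   | i , j , ready with fire-step cut ready distinct c↭
  ...     | c′ , step , distinct′ , c′↭
          with topple-to-full fuel (suc-injective (trans (unfired-fire cut ready) e))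
                              (Fire.cut′ cut ready) distinct′ c′↭
  ...       | c″ , steps , c″↭ = c″ , step ◅ steps , c″↭

  record OutputsIdentity : Set where
    field
      bottom-label : ∀ j → j < C → col T L R j ≡ suc j
      right-label  : ∀ i → i < R → row T L i C ≡ suc (C + mirror i)

  -- In the complete cut column j ends at j - R and row mirror a at C + 1 + a - R: read left
  -- to right these are the chips finalChip 0, …, finalChip (C + R - 1).
  finalPos : ℕ → ℕ
  finalPos a = if a <ᵇ C then a else suc a

  finalLabel : ℕ → ℕ
  finalLabel a = if a <ᵇ C then col T L R a else row T L (mirror (a ∸ C)) C

  finalChip : ℕ → Chip
  finalChip a = (finalPos a ⊖ R , finalLabel a)

  fullConfig≡finalChips : fullConfig ≡ applyUpTo finalChip (C + R)
  fullConfig≡finalChips = trans (cong₂ _++_ (applyUpTo-cong _ _ C cols) (applyUpTo-cong _ _ R rows))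
                                (sym (applyUpTo-++ finalChip C R))
    where
    cols : ∀ j → j < C → colChip (λ _ → R) j ≡ finalChip j
    cols j j<C rewrite <⇒<ᵇ≡true j<C = refl
    C+R≡ : ∀ a → a < R → C + R ≡ suc (C + a) + mirror a
    C+R≡ a a<R = begin
      C + R                       ≡⟨ cong (C +_) (m+[n∸m]≡n a<R) ⟨
      C + (suc a + mirror a)      ≡⟨ +-assoc C (suc a) _ ⟨
      (C + suc a) + mirror a      ≡⟨ cong (_+ mirror a) (+-suc C a) ⟩
      suc (C + a) + mirror a      ∎
      where open ≡-Reasoning
    rows : ∀ a → a < R → rowChip (λ _ → C) (mirror a) ≡ finalChip (C + a)
    rows a a<R rewrite ≥⇒<ᵇ≡false {C + a} {C} (m≤m+n C a) | m+n∸m≡n C a =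
      cong (_, row T L (mirror a) C) (+≡+⇒⊖≡⊖ C (mirror a) (suc (C + a)) R (C+R≡ a a<R))

  _<ₚ_ : Chip → Chip → Set
  x <ₚ y = proj₁ x ℤ.< proj₁ y

  finalChips-sorted : Linked _<ₚ_ (applyUpTo finalChip (C + R))
  finalChips-sorted = Linked.applyUpTo⁺₂ finalChip (C + R) λ a → ℤP.⊖-monoˡ-< R (finalPos-< a)
    where
    finalPos-< : ∀ a → finalPos a < finalPos (suc a)
    finalPos-< a with a <ᵇ C in a<C | suc a <ᵇ C in 1+a<C
    ... | true  | true  = ≤-refl
    ... | true  | false = n≤1+n (suc a)
    ... | false | true  =
      contradiction (≤-trans (<ᵇ≡false⇒≥ {a} {C} a<C) (n≤1+n a)) (<⇒≱ (<ᵇ≡true⇒< {suc a} {C} 1+a<C))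
    ... | false | false = ≤-refl

  finalChips-allPairs : AllPairs _<ₚ_ (applyUpTo finalChip (C + R))
  finalChips-allPairs =
    Linked.Linked⇒AllPairs (λ {x} {y} {z} → ℤP.<-trans {proj₁ x} {proj₁ y} {proj₁ z}) finalChips-sorted

  finalLabel-col : ∀ {j} → j < C → finalLabel j ≡ col T L R j
  finalLabel-col j<C rewrite <⇒<ᵇ≡true j<C = refl

  finalLabel-row : ∀ {a} → C ≤ a → finalLabel a ≡ row T L (mirror (a ∸ C)) C
  finalLabel-row C≤a rewrite ≥⇒<ᵇ≡false C≤a = refl

  finalLabels≡suc⇔outputsIdentity : applyUpTo finalLabel (C + R) ≡ applyUpTo suc (C + R) ⇔ OutputsIdentity
  finalLabels≡suc⇔outputsIdentity = mk⇔ to from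
    where
    to : applyUpTo finalLabel (C + R) ≡ applyUpTo suc (C + R) → OutputsIdentity
    to e = record { bottom-label = bottom ; right-label = right }
      where
      bottom : ∀ j → j < C → col T L R j ≡ suc j
      bottom j j<C = trans (sym (finalLabel-col j<C))
        (applyUpTo-injective finalLabel suc (C + R) e j (<-≤-trans j<C (m≤m+n C R)))
      right : ∀ i → i < R → row T L i C ≡ suc (C + mirror i)
      right i i<R = begin
        row T L i C
          ≡⟨ cong (λ z → row T L z C) (∸-suc-involutive i<R) ⟨
        row T L (mirror (mirror i)) C
          ≡⟨ cong (λ z → row T L (mirror z) C) (m+n∸m≡n C (mirror i)) ⟨
        row T L (mirror ((C + mirror i) ∸ C)) C
          ≡⟨ finalLabel-row (m≤m+n C (mirror i)) ⟨
        finalLabel (C + mirror i)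
          ≡⟨ applyUpTo-injective finalLabel suc (C + R) e _ (+-monoʳ-< C (∸-suc-< i<R)) ⟩
        suc (C + mirror i)
          ∎
        where open ≡-Reasoning
    from : OutputsIdentity → applyUpTo finalLabel (C + R) ≡ applyUpTo suc (C + R)
    from out = applyUpTo-cong finalLabel suc (C + R) label
      where
      open OutputsIdentity out
      label : ∀ a → a < C + R → finalLabel a ≡ suc a
      label a a<C+R with a <? C
      ... | yes a<C = trans (finalLabel-col a<C) (bottom-label a a<C)
      ... | no  a≮C = begin
        finalLabel a                   ≡⟨ finalLabel-row C≤a ⟩
        row T L (mirror (a ∸ C)) C     ≡⟨ right-label _ (∸-suc-< a∸C<R) ⟩
        suc (C + mirror (mirror (a ∸ C))) ≡⟨ cong (λ z → suc (C + z)) (∸-suc-involutive a∸C<R) ⟩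
        suc (C + (a ∸ C))              ≡⟨ cong suc (m+[n∸m]≡n C≤a) ⟩
        suc a                          ∎
        where
        open ≡-Reasoning
        C≤a : C ≤ a
        C≤a = ≮⇒≥ a≮C
        a∸C<R : a ∸ C < R
        a∸C<R = +-cancelˡ-< C (a ∸ C) R (subst (_< C + R) (sym (m+[n∸m]≡n C≤a)) a<C+R)

  outputsIdentity⇒readsIdentity : ∀ {c} n → suc n ≡ C + R → c ↭ fullConfig → OutputsIdentity →
                                  Stable c × ReadsIdentity n c
  outputsIdentity⇒readsIdentity {c} n 1+n≡ c↭ out =
    stable , map proj₁ final , length≡ , Linked.map⁺ finalChips-sorted , c↭zip
    where
    final : Config
    final = applyUpTo finalChip (C + R)
    c↭final : c ↭ final
    c↭final = subst (c ↭_) fullConfig≡finalChips c↭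
    stable : Stable c
    stable = AllPairs-resp-↭ ≢-sym (↭-sym c↭final) (AllPairs.map ℤP.<⇒≢ finalChips-allPairs)
    length≡ : length (map proj₁ final) ≡ suc n
    length≡ = trans (length-map proj₁ final) (trans (length-applyUpTo finalChip (C + R)) (sym 1+n≡))
    labels : map proj₂ final ≡ map suc (upTo (suc n))
    labels = begin
      map proj₂ final               ≡⟨ map-applyUpTo finalChip proj₂ (C + R) ⟩
      applyUpTo finalLabel (C + R)  ≡⟨ Equivalence.from finalLabels≡suc⇔outputsIdentity out ⟩
      applyUpTo suc (C + R)         ≡⟨ cong (applyUpTo suc) 1+n≡ ⟨
      applyUpTo suc (suc n)         ≡⟨ map-upTo suc (suc n) ⟨
      map suc (upTo (suc n))        ∎
      where open ≡-Reasoning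
    c↭zip : c ↭ zip (map proj₁ final) (map suc (upTo (suc n)))
    c↭zip = subst (λ ls → c ↭ zip (map proj₁ final) ls) labels
                  (subst (c ↭_) (sym (zip-map-proj final)) c↭final)

  readsIdentity⇒outputsIdentity : ∀ {c} n → suc n ≡ C + R → c ↭ fullConfig → ReadsIdentity n c →
                                  OutputsIdentity
  readsIdentity⇒outputsIdentity {c} n 1+n≡ c↭ (ps , length≡ , sorted , c↭zip) =
    Equivalence.to finalLabels≡suc⇔outputsIdentity (begin
      applyUpTo finalLabel (C + R)  ≡⟨ map-applyUpTo finalChip proj₂ (C + R) ⟨
      map proj₂ final               ≡⟨ cong (map proj₂) final≡zip ⟩
      map proj₂ (zip ps ids)        ≡⟨ map-proj₂-zip ps ids (trans length≡ (sym length-ids)) ⟩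
      ids                           ≡⟨ map-upTo suc (suc n) ⟩
      applyUpTo suc (suc n)         ≡⟨ cong (applyUpTo suc) 1+n≡ ⟩
      applyUpTo suc (C + R)         ∎)
    where
    open ≡-Reasoning
    final : Config
    final = applyUpTo finalChip (C + R)
    ids : List ℕ
    ids = map suc (upTo (suc n))
    length-ids : length ids ≡ suc n
    length-ids = trans (length-map suc (upTo (suc n))) (length-upTo (suc n))
    final≡zip : final ≡ zip ps ids
    final≡zip = AllPairs-↭-unique (λ {x} {y} → ℤP.<-asym {proj₁ x} {proj₁ y})
      (↭-trans (↭-sym (subst (c ↭_) fullConfig≡finalChips c↭)) c↭zip) finalChips-allPairs
      (Linked.Linked⇒AllPairs (λ {x} {y} {z} → ℤP.<-trans {proj₁ x} {proj₁ y} {proj₁ z})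
                              (Linked-zip⁺ sorted))

-- The configurations π^(r)

relabel-≢ : ∀ r w → relabel r w ≢ r
relabel-≢ r w e with w <ᵇ r in w<r
... | true  = <-irrefl e (<ᵇ≡true⇒< w<r)
... | false = <-irrefl (sym e) (s≤s (<ᵇ≡false⇒≥ w<r))

relabel-injective : ∀ r {a b} → relabel r a ≡ relabel r b → a ≡ b
relabel-injective r {a} {b} e with a <ᵇ r in a<r | b <ᵇ r in b<r
... | true  | true  = e
... | false | false = suc-injective e
... | true  | false =
  contradiction (subst (_< r) e (<ᵇ≡true⇒< a<r)) (≤⇒≯ (≤-trans (<ᵇ≡false⇒≥ b<r) (n≤1+n b)))
... | false | true  =
  contradiction (subst (_< r) (sym e) (<ᵇ≡true⇒< b<r)) (≤⇒≯ (≤-trans (<ᵇ≡false⇒≥ a<r) (n≤1+n a)))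

relabel-suc-≢ : ∀ k {w} → w ≢ k → relabel (suc k) w ≡ relabel k w
relabel-suc-≢ k {w} w≢k with <-cmp w k
... | tri< w<k _ _ rewrite <⇒<ᵇ≡true w<k | <⇒<ᵇ≡true (m<n⇒m<1+n w<k) = refl
... | tri≈ _ w≡k _ = contradiction w≡k w≢k
... | tri> _ _ k<w rewrite ≥⇒<ᵇ≡false {w} {k} (<⇒≤ k<w) | ≥⇒<ᵇ≡false {w} {suc k} k<w = refl

relabel-suc-self : ∀ k → relabel (suc k) k ≡ k
relabel-suc-self k rewrite <⇒<ᵇ≡true (n<1+n k) = refl

relabel-self : ∀ k → relabel k k ≡ suc k
relabel-self k rewrite ≥⇒<ᵇ≡false {k} {k} ≤-refl = refl

<ᵇ-suc-≢ : ∀ {k′ k} → k′ ≢ k → (k′ <ᵇ suc k) ≡ (k′ <ᵇ k)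
<ᵇ-suc-≢ {k′} {k} k′≢k with <-cmp k′ k
... | tri< k′<k _ _ = trans (<⇒<ᵇ≡true (m<n⇒m<1+n k′<k)) (sym (<⇒<ᵇ≡true k′<k))
... | tri≈ _ k′≡k _ = contradiction k′≡k k′≢k
... | tri> _ _ k<k′ = trans (≥⇒<ᵇ≡false k<k′) (sym (≥⇒<ᵇ≡false (<⇒≤ k<k′)))

<ᵇ-relabel-suc : ∀ {k′ k} w → k′ ≢ k → (k′ <ᵇ relabel (suc k) w) ≡ (k′ <ᵇ relabel k w)
<ᵇ-relabel-suc {k′} {k} w k′≢k with w ≟ k
... | yes refl rewrite relabel-suc-self w | relabel-self w = sym (<ᵇ-suc-≢ k′≢k)
... | no  w≢k  = cong (k′ <ᵇ_) (relabel-suc-≢ k w≢k)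

-- Entry a of π is the chip at position a - R′. The chips at positions -R′ … 0 are the rows
-- (row i at -i), the extra chip r at the origin is column 0, and the chips at positions
-- 1 … C′ are the columns 1 … C′.
module Toppleability (n : ℕ) (π : Permutation′ n) (R′ C′ : ℕ)
               (n≡ : n ≡ suc R′ + C′) (half≡ : (n ∸ 1) / 2 ≡ R′) where

  R C : ℕ
  R = suc R′
  C = suc C′

  entry : ℕ → ℕ
  entry a with a <? n
  ... | yes a<n = suc (toℕ (π ⟨$⟩ʳ fromℕ< a<n))
  ... | no  _   = 0

  entry-toℕ : ∀ (j : Fin n) → entry (toℕ j) ≡ suc (toℕ (π ⟨$⟩ʳ j))
  entry-toℕ j with toℕ j <? n
  ... | yes j<n = cong (λ z → suc (toℕ (π ⟨$⟩ʳ z))) (Fin.fromℕ<-toℕ j j<n)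
  ... | no  j≮n = contradiction (Fin.toℕ<n j) j≮n

  label : ℕ → ℕ → ℕ
  label r a = relabel r (entry a)

  top : ℕ → ℕ → ℕ
  top r zero    = r
  top r (suc c) = label r (R + c)

  -- Beyond the R rows left r is 0, so that there its thresholds do not depend on r.
  left : ℕ → ℕ → ℕ
  left r i = if i <ᵇ R then label r (R ∸ suc i) else 0

  module Topple (r : ℕ) = Toppling (top r) (left r) R C

  cut₀ : ∀ r → Topple.Cut r (λ _ → 0) (λ _ → 0)
  cut₀ r = record
    { col⇒row = λ _ _ _ _ () ; row⇒col = λ _ _ _ _ () ; h≤R = λ _ _ → z≤n ; g≤C = λ _ _ → z≤n }

  initial↭cutConfig : ∀ r → initial n π r ↭ Topple.cutConfig r (λ _ → 0) (λ _ → 0)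
  initial↭cutConfig r = prep (ℤ.+ 0 , r) (↭-trans (↭-reflexive chips≡) (++-comm rows cols))
    where
    initialChip : Fin n → Chip
    initialChip j = (ℤ.- ℤ.+ ((n ∸ 1) / 2) ℤ.+ ℤ.+ toℕ j , relabel r (suc (toℕ (π ⟨$⟩ʳ j))))
    chip : ℕ → Chip
    chip a = (a ⊖ R′ , label r a)
    rows cols : Config
    rows = applyUpTo (Topple.rowChip r (λ _ → 0) ∘ Topple.mirror r) R
    cols = applyUpTo (Topple.colChip r (λ _ → 0) ∘ suc) C′
    initialChip≡chip : ∀ j → initialChip j ≡ chip (toℕ j)
    initialChip≡chip j = cong₂ _,_
      (trans (cong (λ z → ℤ.- ℤ.+ z ℤ.+ ℤ.+ toℕ j) half≡) (ℤP.-m+n≡n⊖m R′ (toℕ j)))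
      (cong (relabel r) (sym (entry-toℕ j)))
    chip-row : ∀ a → a < R → chip a ≡ Topple.rowChip r (λ _ → 0) (Topple.mirror r a)
    chip-row a (s≤s a≤R′)
      rewrite <⇒<ᵇ≡true {R′ ∸ a} {R} (s≤s (m∸n≤m R′ a)) | m∸[m∸n]≡n a≤R′ =
      cong (_, label r a) (+≡+⇒⊖≡⊖ a R′ 0 (R′ ∸ a) (m+[n∸m]≡n a≤R′))
    chip-col : ∀ c → c < C′ → chip (R + c) ≡ Topple.colChip r (λ _ → 0) (suc c)
    chip-col c _ = cong (_, label r (R + c))
      (+≡+⇒⊖≡⊖ (R + c) R′ (suc c) 0 (trans (+-identityʳ (R + c)) (cong suc (+-comm R′ c))))
    chips≡ : map initialChip (allFin n) ≡ rows ++ cols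
    chips≡ = begin
      map initialChip (allFin n)                        ≡⟨ map-tabulate id initialChip ⟩
      tabulate initialChip                              ≡⟨ tabulate≡applyUpTo initialChip chip initialChip≡chip ⟩
      applyUpTo chip n                                  ≡⟨ cong (applyUpTo chip) n≡ ⟩
      applyUpTo chip (R + C′)                           ≡⟨ applyUpTo-++ chip R C′ ⟩
      applyUpTo chip R ++ applyUpTo (chip ∘ (R +_)) C′  ≡⟨ cong₂ _++_ (applyUpTo-cong _ _ R chip-row)
                                                                      (applyUpTo-cong _ _ C′ chip-col) ⟩
      rows ++ cols                                      ∎
      where open ≡-Reasoning

  distinctLabels₀ : ∀ r → Topple.DistinctLabels r (initial n π r)
  distinctLabels₀ r = subst (All _) (sym (map-tabulate id _)) (All.tabulate⁺ λ j e → relabel-≢ r _ (sym e))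
                    ∷ subst (AllPairs _) (sym (map-tabulate id _)) (AllPairs.tabulate⁺ λ {i} {j} i≢j e →
                        i≢j (π-injective (Fin.toℕ-injective (suc-injective (relabel-injective r e)))))
    where
    π-injective : ∀ {i j : Fin n} → π ⟨$⟩ʳ i ≡ π ⟨$⟩ʳ j → i ≡ j
    π-injective {i} {j} e = trans (sym (inverseˡ π)) (trans (cong (π ⟨$⟩ˡ_) e) (inverseˡ π))

  1+n≡C+R : suc n ≡ C + R
  1+n≡C+R = trans (cong suc n≡) (cong suc (+-comm R C′))

  toppleable⇔outputsIdentity : ∀ r → Toppleable n π r ⇔ Topple.OutputsIdentity r
  toppleable⇔outputsIdentity r = mk⇔ to from
    where
    to : Toppleable n π r → Topple.OutputsIdentity r
    to (c , moves , stable , reads) with Topple.reachable⇒cutConfig r (cut₀ r) (initial↭cutConfig r) moves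
    ... | h , g , cut , c↭ = Topple.readsIdentity⇒outputsIdentity r n 1+n≡C+R
            (subst (c ↭_) (Topple.complete⇒fullConfig r cut (Topple.stable⇒complete r cut c↭ stable)) c↭)
            reads
    from : Topple.OutputsIdentity r → Toppleable n π r
    from out with Topple.topple-to-full r _ refl (cut₀ r) (distinctLabels₀ r) (initial↭cutConfig r)
    ... | c , moves , c↭ = c , moves , Topple.outputsIdentity⇒readsIdentity r n 1+n≡C+R c↭ out

  open Outputs R C

  IdentityAtAll : ℕ → Set
  IdentityAtAll r = ∀ k → IdentityAt k (threshold k (top r)) (threshold k (left r))

  outputsIdentity⇔identityAtAll : ∀ r → Topple.OutputsIdentity r ⇔ IdentityAtAll r
  outputsIdentity⇔identityAtAll r = mk⇔ to from
    where
    to : Topple.OutputsIdentity r → IdentityAtAll r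
    to out k = record
      { bottom-id = λ j j<C →
          trans (sym (col-threshold k (top r) (left r) R j)) (cong (k <ᵇ_) (bottom-label j j<C))
      ; right-id  = λ i i<R →
          trans (sym (row-threshold k (top r) (left r) i C)) (cong (k <ᵇ_) (right-label i i<R)) }
      where open Topple.OutputsIdentity r out
    from : IdentityAtAll r → Topple.OutputsIdentity r
    from ids = record
      { bottom-label = λ j j<C → thresholds-injective λ k →
          trans (col-threshold k (top r) (left r) R j) (IdentityAt.bottom-id (ids k) j j<C)
      ; right-label  = λ i i<R → thresholds-injective λ k →
          trans (row-threshold k (top r) (left r) i C) (IdentityAt.right-id (ids k) i i<R) }

  toppleable⇔identityAtAll : ∀ r → Toppleable n π r ⇔ IdentityAtAll r
  toppleable⇔identityAtAll r = outputsIdentity⇔identityAtAll r ⇔-∘ toppleable⇔outputsIdentity r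

  top-threshold-suc : ∀ {k′ k} → k′ ≢ k → ∀ c →
                      threshold k′ (top (suc k)) c ≡ threshold k′ (top k) c
  top-threshold-suc k′≢k zero    = <ᵇ-suc-≢ k′≢k
  top-threshold-suc k′≢k (suc c) = <ᵇ-relabel-suc (entry (R + c)) k′≢k

  left-threshold-suc : ∀ {k′ k} → k′ ≢ k → ∀ i →
                       threshold k′ (left (suc k)) i ≡ threshold k′ (left k) i
  left-threshold-suc k′≢k i with i <ᵇ R
  ... | true  = <ᵇ-relabel-suc (entry (R ∸ suc i)) k′≢k
  ... | false = refl

  entry-preimage : ∀ {k} → 1 ≤ k → k ≤ n →
                   Σ ℕ λ p → p < n × entry p ≡ k × (∀ a → entry a ≡ k → a ≡ p)
  entry-preimage {suc k₀} _ k₀<n = toℕ j , Fin.toℕ<n j , entry-p , unique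
    where
    j : Fin n
    j = π ⟨$⟩ˡ fromℕ< k₀<n
    entry-p : entry (toℕ j) ≡ suc k₀
    entry-p = trans (entry-toℕ j) (cong suc (trans (cong toℕ (inverseʳ π)) (Fin.toℕ-fromℕ< k₀<n)))
    unique : ∀ a → entry a ≡ suc k₀ → a ≡ toℕ j
    unique a e with a <? n
    ... | yes a<n = trans (sym (Fin.toℕ-fromℕ< a<n)) (cong toℕ (trans (sym (inverseˡ π))
                      (cong (π ⟨$⟩ˡ_) (Fin.toℕ-injective
                        (trans (suc-injective e) (sym (Fin.toℕ-fromℕ< k₀<n)))))))
    ... | no  _   = contradiction e λ ()

  -- Passing from r = suc k to r = k moves the 1 of threshold k from the origin chip to the
  -- chip labelled k, which is a row or one of the columns 1 … C′.
  module ThresholdAtK (k : ℕ) (1≤k : 1 ≤ k) (k≤n : k ≤ n) where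
    X BX Y BY : ℕ → Bool
    X  = threshold k (top (suc k))
    BX = threshold k (left (suc k))
    Y  = threshold k (top k)
    BY = threshold k (left k)

    X0 : X 0 ≡ true
    X0 = <⇒<ᵇ≡true (n<1+n k)

    Y0 : Y 0 ≡ false
    Y0 = ≥⇒<ᵇ≡false {k} ≤-refl

    p : ℕ
    p = proj₁ (entry-preimage 1≤k k≤n)

    p<n : p < n
    p<n = proj₁ (proj₂ (entry-preimage 1≤k k≤n))

    entry-p : entry p ≡ k
    entry-p = proj₁ (proj₂ (proj₂ (entry-preimage 1≤k k≤n)))

    p-unique : ∀ a → entry a ≡ k → a ≡ p
    p-unique = proj₂ (proj₂ (proj₂ (entry-preimage 1≤k k≤n)))

    agree : ∀ {a} → a ≢ p → (k <ᵇ label k a) ≡ (k <ᵇ label (suc k) a)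
    agree a≢p = cong (k <ᵇ_) (sym (relabel-suc-≢ k λ e → a≢p (p-unique _ e)))

    at-p-X : (k <ᵇ label (suc k) p) ≡ false
    at-p-X rewrite entry-p | relabel-suc-self k = ≥⇒<ᵇ≡false {k} ≤-refl

    at-p-Y : (k <ᵇ label k p) ≡ true
    at-p-Y rewrite entry-p | relabel-self k = <⇒<ᵇ≡true (n<1+n k)

    cornerMoved : CornerMoved X BX Y BY
    cornerMoved with p <? R
    ... | yes p<R = toRow i₀<R BXi₀ BYi₀ rows cols
      where
      i₀ : ℕ
      i₀ = R ∸ suc p
      i₀<R : i₀ < R
      i₀<R = ∸-suc-< p<R
      BXi₀ : BX i₀ ≡ false
      BXi₀ rewrite <⇒<ᵇ≡true i₀<R | ∸-suc-involutive p<R = at-p-X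
      BYi₀ : BY i₀ ≡ true
      BYi₀ rewrite <⇒<ᵇ≡true i₀<R | ∸-suc-involutive p<R = at-p-Y
      rows : ∀ i → i ≢ i₀ → BY i ≡ BX i
      rows i i≢i₀ with i <ᵇ R in i<R
      ... | true  = agree λ e →
        i≢i₀ (trans (sym (∸-suc-involutive {R} (<ᵇ≡true⇒< {i} i<R))) (cong (λ z → R ∸ suc z) e))
      ... | false = refl
      cols : ∀ c → c ≢ 0 → Y c ≡ X c
      cols zero    c≢0 = contradiction refl c≢0
      cols (suc c) _   = agree λ e → <-irrefl (sym e) (<-≤-trans p<R (m≤m+n R c))
    ... | no p≮R = toColumn (s≤s z≤n) p′<C Xp′ Yp′ cols rows
      where
      R≤p : R ≤ p
      R≤p = ≮⇒≥ p≮R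
      p′ : ℕ
      p′ = suc (p ∸ R)
      R+[p∸R]≡p : R + (p ∸ R) ≡ p
      R+[p∸R]≡p = m+[n∸m]≡n R≤p
      p′<C : p′ < C
      p′<C = s≤s (subst (p ∸ R <_) (m+n∸m≡n R C′) (∸-monoˡ-< (subst (p <_) n≡ p<n) R≤p))
      Xp′ : X p′ ≡ false
      Xp′ = subst (λ z → (k <ᵇ label (suc k) z) ≡ false) (sym R+[p∸R]≡p) at-p-X
      Yp′ : Y p′ ≡ true
      Yp′ = subst (λ z → (k <ᵇ label k z) ≡ true) (sym R+[p∸R]≡p) at-p-Y
      cols : ∀ c → c ≢ 0 → c ≢ p′ → Y c ≡ X c
      cols zero    c≢0 _    = contradiction refl c≢0
      cols (suc c) _   c≢p′ = agree λ e → c≢p′ (cong suc (trans (sym (m+n∸m≡n R c)) (cong (_∸ R) e)))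
      rows : ∀ i → BY i ≡ BX i
      rows i with i <ᵇ R in i<R
      ... | true  = agree λ e → <-irrefl e (<-≤-trans (∸-suc-< {R} (<ᵇ≡true⇒< {i} i<R)) R≤p)
      ... | false = refl

  lower : ∀ k → 1 ≤ k → k ≤ C → Toppleable n π (suc k) → Toppleable n π k
  lower k 1≤k k≤C = Equivalence.from (toppleable⇔identityAtAll k) ∘ lowered
                  ∘ Equivalence.to (toppleable⇔identityAtAll (suc k))
    where
    open ThresholdAtK k 1≤k (≤-trans k≤C (subst (C ≤_) (sym n≡) (s≤s (m≤n+m C′ R′))))
    lowered : IdentityAtAll (suc k) → IdentityAtAll k
    lowered ids k′ with k′ ≟ k
    ... | yes refl = identityAt-moveCorner 1≤k k≤C X0 Y0 cornerMoved (ids k)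
    ... | no  k′≢k =
      identityAt-cong (sym ∘ top-threshold-suc k′≢k) (sym ∘ left-threshold-suc k′≢k) (ids k′)

  raise : ∀ k → C ≤ k → k ≤ n → Toppleable n π k → Toppleable n π (suc k)
  raise k C≤k k≤n = Equivalence.from (toppleable⇔identityAtAll (suc k)) ∘ raised
                  ∘ Equivalence.to (toppleable⇔identityAtAll k)
    where
    open ThresholdAtK k (≤-trans (s≤s z≤n) C≤k) k≤n
    raised : IdentityAtAll k → IdentityAtAll (suc k)
    raised ids k′ with k′ ≟ k
    ... | yes refl = identityAt-restoreCorner (s≤s z≤n) C≤k X0 Y0 cornerMoved (ids k)
    ... | no  k′≢k = identityAt-cong (top-threshold-suc k′≢k) (left-threshold-suc k′≢k) (ids k′)

toppleable-propagates : ∀ {n} (π : Permutation′ n) m → 1 ≤ m → 2 * m ≤ n →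
  (∀ k → 1 ≤ k → k ≤ suc m → Toppleable n π (suc k) → Toppleable n π k) →
  (∀ k → suc m ≤ k → k ≤ n → Toppleable n π k → Toppleable n π (suc k)) →
  ((r : ℕ) → 2 ≤ r → r ≤ m + 1 → Toppleable n π r → Toppleable n π (r ∸ 1))
  × ((r : ℕ) → m + 2 ≤ r → r ≤ 2 * m → Toppleable n π r → Toppleable n π (r + 1))
  × (Toppleable n π (m + 1) ⇔ Toppleable n π (m + 2))
toppleable-propagates {n} π m 1≤m 2m≤n lower raise rewrite +-comm m 1 | +-comm m 2 =
  downwards , upwards , mk⇔ (raise (suc m) ≤-refl 1+m≤n) (lower (suc m) (s≤s z≤n) ≤-refl)
  where
  1+m≤n : suc m ≤ n
  1+m≤n = ≤-trans (+-monoˡ-≤ m 1≤m) (≤-trans (+-monoʳ-≤ m (m≤m+n m 0)) 2m≤n)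
  downwards : (r : ℕ) → 2 ≤ r → r ≤ suc m → Toppleable n π r → Toppleable n π (r ∸ 1)
  downwards (suc (suc k)) (s≤s (s≤s z≤n)) r≤1+m =
    lower (suc k) (s≤s z≤n) (≤-trans (s≤s⁻¹ r≤1+m) (n≤1+n m))
  upwards : (r : ℕ) → suc (suc m) ≤ r → r ≤ 2 * m → Toppleable n π r → Toppleable n π (r + 1)
  upwards r 2+m≤r r≤2m rewrite +-comm r 1 =
    raise r (≤-trans (n≤1+n (suc m)) 2+m≤r) (≤-trans r≤2m 2m≤n)

half-double : ∀ m → (m + m) / 2 ≡ m
half-double m = trans (cong (_/ 2) (trans (cong (m +_) (sym (+-identityʳ m))) (*-comm 2 m))) (m*n/n≡m m 2)

half-suc-double : ∀ m → suc (m + m) / 2 ≡ m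
half-suc-double zero    = refl
half-suc-double (suc m) = trans (m/n≡1+[m∸n]/n {suc (suc m + suc m)} {2} (s≤s (s≤s z≤n)))
                                (cong suc (trans (cong (_/ 2) (+-suc m m)) (half-suc-double m)))

theorem3p1 : (m : ℕ) → 1 ≤ m →
  ((π : Permutation′ (2 * m + 1)) →
    ((r : ℕ) → 2 ≤ r → r ≤ m + 1 →
      Toppleable (2 * m + 1) π r → Toppleable (2 * m + 1) π (r ∸ 1))
    × ((r : ℕ) → m + 2 ≤ r → r ≤ 2 * m →
      Toppleable (2 * m + 1) π r → Toppleable (2 * m + 1) π (r + 1))
    × (Toppleable (2 * m + 1) π (m + 1) ⇔ Toppleable (2 * m + 1) π (m + 2)))
  × ((π : Permutation′ (2 * m)) →
    ((r : ℕ) → 2 ≤ r → r ≤ m + 1 →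
      Toppleable (2 * m) π r → Toppleable (2 * m) π (r ∸ 1))
    × ((r : ℕ) → m + 2 ≤ r → r ≤ 2 * m →
      Toppleable (2 * m) π r → Toppleable (2 * m) π (r + 1))
    × (Toppleable (2 * m) π (m + 1) ⇔ Toppleable (2 * m) π (m + 2)))
theorem3p1 m@(suc m′) 1≤m =
  (λ π → let open Toppleability (2 * m + 1) π m m 2m+1≡1+m+m [2m+1∸1]/2≡m in
         toppleable-propagates π m 1≤m (m≤m+n (2 * m) 1) lower raise) ,
  (λ π → let open Toppleability (2 * m) π m′ m 2m≡m+m [2m∸1]/2≡m′ in
         toppleable-propagates π m 1≤m ≤-refl lower raise)
  where
  2m≡m+m : 2 * m ≡ m + m
  2m≡m+m = cong (m +_) (+-identityʳ m)
  2m+1≡1+m+m : 2 * m + 1 ≡ suc m + m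
  2m+1≡1+m+m = trans (+-comm (2 * m) 1) (cong suc 2m≡m+m)
  [2m+1∸1]/2≡m : (2 * m + 1 ∸ 1) / 2 ≡ m
  [2m+1∸1]/2≡m = trans (cong (_/ 2) (trans (m+n∸n≡m (2 * m) 1) 2m≡m+m)) (half-double m)
  [2m∸1]/2≡m′ : (2 * m ∸ 1) / 2 ≡ m′
  [2m∸1]/2≡m′ =
    trans (cong (_/ 2) (trans (+-suc m′ (m′ + 0)) (cong (suc ∘ (m′ +_)) (+-identityʳ m′))))
          (half-suc-double m′)
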